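{- Let $B_s$ denote the Bernoulli numbers ($B_0=1$, $B_s=-\frac{1}{s+1}\sum_{k=0}^{s-1}\binom{s+1}{k}B_k$ for $s\ge1$). Define $B^*_0=1$, $B^*_1=\frac14$ and, for $s\ge2$, $B^*_s=-\frac{1}{s+1}\sum_{k=0}^{s-1}\binom{s+1}{k}2^{k-s}B_k$. For integers $s\ge0$ let \[R_{2s+1}(z)=\sum_{k=0}^{s+1}\frac{B_{2k}B_{2s+2-2k}}{(2k)!(2s+2-2k)!}z^{2k},\] and for integers $r\ge0$ let \[Q_r(z)=\sum_{k=0}^{\lfloor (r+1)/2\rfloor}\frac{B^*_{r+1-2k}B^*_{2k}}{(r+1-2k)!(2k)!}z^{2k}.\] Then for every integer $s\ge0$: $Q_{2s+1}(z)=R_{2s+1}(z)$, and \[Q_{2s}(z)=4z^{2s+2}\left(R_{2s+1}\left(\tfrac1z\right)-R_{2s+1}\left(\tfrac1{2z}\right)\right)=4\left(R_{2s+1}(z)-\frac{1}{2^{2s+2}}R_{2s+1}(2z)\right).\] Moreover, writing $R_{2s}(z):=Q_{2s}(z)$, the two-term reciprocal relation \[R_{2s}(z)-R_{2s}\left(\tfrac z2\right)=z^{2s+2}\left(R_{2s}\left(\tfrac1z\right)-R_{2s}\left(\tfrac1{2z}\right)\right)\] holds.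
   Context: $\lfloor\cdot\rfloor$ denotes the integer part. The polynomials $R_{2s+1}$ are the (odd-indexed) Ramanujan polynomials; they satisfy $R_{2s+1}(z)=z^{2s+2}R_{2s+1}(1/z)$. -}

module Defs where

open import Data.Nat as ℕ using (ℕ; zero; suc; _!; _∸_)
open import Data.Nat.Properties using (_!≢0; m^n≢0)
open import Data.Nat.Combinatorics using (_C_)
open import Data.Integer using (+_)
open import Data.List using (List; []; _∷_; _++_; [_]; zipWith; upTo; foldr)
open import Data.Rational using (ℚ; _/_; _+_; _*_; -_; 0ℚ; 1ℚ)

ℕ→ℚ : ℕ → ℚ
ℕ→ℚ n = + n / 1

inv! : ℕ → ℚ
inv! n = _/_ (+ 1) (n !) {{n !≢0}}

inv2^ : ℕ → ℚ
inv2^ m = _/_ (+ 1) (2 ℕ.^ m) {{m^n≢0 2 m}}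

_^ℚ_ : ℚ → ℕ → ℚ
q ^ℚ zero = 1ℚ
q ^ℚ suc n = q * (q ^ℚ n)

infixr 8 _^ℚ_

sumTo : ℕ → (ℕ → ℚ) → ℚ
sumTo zero f = f 0
sumTo (suc n) f = sumTo n f + f (suc n)

nth : List ℚ → ℕ → ℚ
nth [] _ = 0ℚ
nth (x ∷ xs) zero = x
nth (x ∷ xs) (suc n) = nth xs n

-- given s ≥ 1 and l = [B_0,…,B_{s-1}], compute B_s = -1/(s+1) Σ_{k<s} C(s+1,k) B_k
bernNext : ℕ → List ℚ → ℚ
bernNext s l = - ((+ 1 / suc s) * foldr _+_ 0ℚ (zipWith (λ k b → ℕ→ℚ (suc s C k) * b) (upTo s) l))

bernList : ℕ → List ℚ
bernList zero = [ 1ℚ ]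
bernList (suc n) = bernList n ++ [ bernNext (suc n) (bernList n) ]

-- Bernoulli numbers B_s (B_1 = -1/2 convention)
B : ℕ → ℚ
B s = nth (bernList s) s

B* : ℕ → ℚ
B* zero = 1ℚ
B* (suc zero) = + 1 / 4
B* s@(suc (suc _)) =
  - ((+ 1 / suc s) * sumTo (s ∸ 1) (λ k → ℕ→ℚ (suc s C k) * inv2^ (s ∸ k) * B k))

-- R_{2s+1}(z)
R : ℕ → ℚ → ℚ
R s z = sumTo (suc s) (λ k →
  B (2 ℕ.* k) * B (2 ℕ.* s ℕ.+ 2 ∸ 2 ℕ.* k)
    * inv! (2 ℕ.* k) * inv! (2 ℕ.* s ℕ.+ 2 ∸ 2 ℕ.* k) * z ^ℚ (2 ℕ.* k))

Q : ℕ → ℚ → ℚ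
Q r z = sumTo (suc r ℕ./ 2) (λ k →
  B* (suc r ∸ 2 ℕ.* k) * B* (2 ℕ.* k)
    * inv! (suc r ∸ 2 ℕ.* k) * inv! (2 ℕ.* k) * z ^ℚ (2 ℕ.* k))

-- The coefficients of both families of polynomials are products of the
-- numbers β_n = B_n / n!, the coefficients of β(x) = x / (eˣ − 1).  We treat
-- exponential generating functions as sequences ℕ → ℚ under the Cauchy
-- product ⊛ and prove three facts about β:
--   * β(x)(eˣ − 1) = x          (the defining recurrence of B),
--   * β(−x) = β(x) + x          (hence B_{2m+3} = 0),
--   * β(2x)(eˣ + 1) = 2β(x)     (the duplication formula).
-- The last two follow by cancelling a common factor eˣ − 1 or e^{−x} − 1;
-- the exponential law e^{px} e^{qx} = e^{(p+q)x} behind them comes from the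
-- uniqueness of solutions of f′ = cf.  Comparing coefficients in the
-- duplication formula gives B*_s / s! = β_s + (4 − 2^{1−s}) β_{s+1} for
-- s ≥ 2, so B*_{2m} = B_{2m} and B*_{2m+1} / (2m+1)! = (4 − 2^{−2m}) β_{2m+2}.
-- Substituting termwise, Q_{2s+1} is literally R_{2s+1}, and
-- Q_{2s}(z) = 4 (R(z) − 2^{−(2s+2)} R(2z)).  The palindromic symmetry
-- R(x) = x^{2s+2} R(1/x), applied at z, 2z and z/2, turns this last identity
-- into the two remaining statements.

module Submission where

open import Defs
open import Data.Nat as ℕ using (ℕ; zero; suc; _!; _∸_; z≤n; s≤s)
open import Data.Nat.Properties as ℕP using (_!≢0; _!*_!≢0)
open import Data.Nat.Combinatorics
  using (_C_; nCk≡n!/k![n-k]!; k![n∸k]!∣n!; nCk≡nC[n∸k]; nC1≡n)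
import Data.Nat.DivMod as ℕD
open import Data.Nat.Coprimality as Coprime using ()
open import Data.Integer as ℤ using (+_)
import Data.Integer.Properties as ℤP
import Data.Integer.Solver as ℤSolver
open import Data.Rational as ℚ
  using (ℚ; mkℚ; NonZero; _/_; _+_; _*_; _-_; -_; 1/_; ½; 0ℚ; 1ℚ; toℚᵘ)
open import Data.Rational.Properties
import Data.Rational.Solver as ℚSolver
open import Data.Rational.Unnormalised as ℚᵘ using (mkℚᵘ; *≡*)
import Data.Rational.Unnormalised.Properties as ℚᵘP
open import Data.List as List using (List; []; _∷_; _++_; [_]; zipWith; applyUpTo; foldr; length)
import Data.List.Properties as ListP
open import Data.Product using (_×_; _,_)
open import Data.Sum using (inj₁; inj₂)
open import Relation.Binary.PropositionalEquality
  using (_≡_; refl; sym; trans; cong; cong₂; subst; module ≡-Reasoning)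

open ℚSolver.+-*-Solver

ℕ→ℚ≡mkℚ : ∀ n → ℕ→ℚ n ≡ mkℚ (+ n) 0 (Coprime.sym (Coprime.1-coprimeTo n))
ℕ→ℚ≡mkℚ n = normalize-coprime (Coprime.sym (Coprime.1-coprimeTo n))

ℕ→ℚ-suc : ∀ n → ℕ→ℚ (suc n) ≡ 1ℚ + ℕ→ℚ n
ℕ→ℚ-suc n = toℚᵘ-injective (begin
    toℚᵘ (ℕ→ℚ (suc n))       ≡⟨ cong toℚᵘ (ℕ→ℚ≡mkℚ (suc n)) ⟩
    mkℚᵘ (+ suc n) 0         ≈⟨ *≡* cross ⟩
    toℚᵘ 1ℚ ℚᵘ.+ mkℚᵘ (+ n) 0 ≡⟨ cong (λ w → toℚᵘ 1ℚ ℚᵘ.+ toℚᵘ w) (sym (ℕ→ℚ≡mkℚ n)) ⟩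
    toℚᵘ 1ℚ ℚᵘ.+ toℚᵘ (ℕ→ℚ n) ≈⟨ ℚᵘP.≃-sym (toℚᵘ-homo-+ 1ℚ (ℕ→ℚ n)) ⟩
    toℚᵘ (1ℚ + ℕ→ℚ n)         ∎)
  where
  open import Relation.Binary.Reasoning.Setoid ℚᵘP.≃-setoid
  open ℤSolver.+-*-Solver renaming (solve to ℤsolve; _:+_ to _⊞_; _:*_ to _⊠_; _:=_ to _≐_; con to ℤcon)
  cross : + suc n ℤ.* (+ 1 ℤ.* + 1) ≡ (+ 1 ℤ.* + 1 ℤ.+ + n ℤ.* + 1) ℤ.* + 1
  cross = trans (cong (ℤ._* (+ 1 ℤ.* + 1)) (ℤP.pos-+ 1 n))
    (ℤsolve 1 (λ x → (ℤcon (+ 1) ⊞ x) ⊠ (ℤcon (+ 1) ⊠ ℤcon (+ 1))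
                  ≐ (ℤcon (+ 1) ⊠ ℤcon (+ 1) ⊞ x ⊠ ℤcon (+ 1)) ⊠ ℤcon (+ 1)) refl (+ n))

ℕ→ℚ-+ : ∀ m n → ℕ→ℚ (m ℕ.+ n) ≡ ℕ→ℚ m + ℕ→ℚ n
ℕ→ℚ-+ zero n = sym (+-identityˡ (ℕ→ℚ n))
ℕ→ℚ-+ (suc m) n = begin
  ℕ→ℚ (suc (m ℕ.+ n))      ≡⟨ ℕ→ℚ-suc (m ℕ.+ n) ⟩
  1ℚ + ℕ→ℚ (m ℕ.+ n)       ≡⟨ cong (λ w → 1ℚ + w) (ℕ→ℚ-+ m n) ⟩
  1ℚ + (ℕ→ℚ m + ℕ→ℚ n)     ≡⟨ sym (+-assoc 1ℚ (ℕ→ℚ m) (ℕ→ℚ n)) ⟩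
  (1ℚ + ℕ→ℚ m) + ℕ→ℚ n     ≡⟨ cong (_+ ℕ→ℚ n) (sym (ℕ→ℚ-suc m)) ⟩
  ℕ→ℚ (suc m) + ℕ→ℚ n      ∎
  where open ≡-Reasoning

ℕ→ℚ-* : ∀ m n → ℕ→ℚ (m ℕ.* n) ≡ ℕ→ℚ m * ℕ→ℚ n
ℕ→ℚ-* zero n = sym (*-zeroˡ (ℕ→ℚ n))
ℕ→ℚ-* (suc m) n = begin
  ℕ→ℚ (n ℕ.+ m ℕ.* n)      ≡⟨ ℕ→ℚ-+ n (m ℕ.* n) ⟩
  ℕ→ℚ n + ℕ→ℚ (m ℕ.* n)    ≡⟨ cong (λ w → ℕ→ℚ n + w) (ℕ→ℚ-* m n) ⟩
  ℕ→ℚ n + ℕ→ℚ m * ℕ→ℚ n    ≡⟨ solve 2 (λ a b → b :+ a :* b := (con 1ℚ :+ a) :* b) refl (ℕ→ℚ m) (ℕ→ℚ n) ⟩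
  (1ℚ + ℕ→ℚ m) * ℕ→ℚ n     ≡⟨ cong (_* ℕ→ℚ n) (sym (ℕ→ℚ-suc m)) ⟩
  ℕ→ℚ (suc m) * ℕ→ℚ n      ∎
  where open ≡-Reasoning

ℕ→ℚ-^ : ∀ m n → ℕ→ℚ (m ℕ.^ n) ≡ ℕ→ℚ m ^ℚ n
ℕ→ℚ-^ m zero = refl
ℕ→ℚ-^ m (suc n) = trans (ℕ→ℚ-* m (m ℕ.^ n)) (cong (ℕ→ℚ m *_) (ℕ→ℚ-^ m n))

1/n*n≡1 : ∀ d .{{_ : ℕ.NonZero d}} → (+ 1 / d) * ℕ→ℚ d ≡ 1ℚ
1/n*n≡1 (suc n) = begin
  (+ 1 / suc n) * ℕ→ℚ (suc n)
    ≡⟨ cong₂ _*_ (normalize-coprime (Coprime.1-coprimeTo (suc n))) (ℕ→ℚ≡mkℚ (suc n)) ⟩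
  mkℚ (+ 1) n (Coprime.1-coprimeTo (suc n)) * mkℚ (+ suc n) 0 (Coprime.sym (Coprime.1-coprimeTo (suc n)))
    ≡⟨ *-inverseˡ (mkℚ (+ suc n) 0 (Coprime.sym (Coprime.1-coprimeTo (suc n)))) ⟩
  1ℚ ∎
  where open ≡-Reasoning

-- Inverses are unique; this is how closed forms for 1/n! and 1/2ᵐ are
-- identified.
inverse-unique : ∀ a x y → a * x ≡ 1ℚ → a * y ≡ 1ℚ → x ≡ y
inverse-unique a x y ax≡1 ay≡1 = begin
  x            ≡⟨ sym (*-identityʳ x) ⟩
  x * 1ℚ       ≡⟨ cong (x *_) (sym ay≡1) ⟩
  x * (a * y)  ≡⟨ solve 3 (λ x a y → x :* (a :* y) := (a :* x) :* y) refl x a y ⟩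
  (a * x) * y  ≡⟨ cong (_* y) ax≡1 ⟩
  1ℚ * y       ≡⟨ *-identityˡ y ⟩
  y            ∎
  where open ≡-Reasoning

cancel-invertible : ∀ a a⁻¹ x y → a⁻¹ * a ≡ 1ℚ → a * x ≡ a * y → x ≡ y
cancel-invertible a a⁻¹ x y inv ax≡ay = begin
  x                ≡⟨ solve 1 (λ x → x := con 1ℚ :* x) refl x ⟩
  1ℚ * x           ≡⟨ cong (_* x) (sym inv) ⟩
  a⁻¹ * a * x      ≡⟨ *-assoc a⁻¹ a x ⟩
  a⁻¹ * (a * x)    ≡⟨ cong (a⁻¹ *_) ax≡ay ⟩
  a⁻¹ * (a * y)    ≡⟨ sym (*-assoc a⁻¹ a y) ⟩
  a⁻¹ * a * y      ≡⟨ cong (_* y) inv ⟩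
  1ℚ * y           ≡⟨ *-identityˡ y ⟩
  y                ∎
  where open ≡-Reasoning

inv!*n! : ∀ n → inv! n * ℕ→ℚ (n !) ≡ 1ℚ
inv!*n! n = 1/n*n≡1 (n !) {{n !≢0}}

n!*inv! : ∀ n → ℕ→ℚ (n !) * inv! n ≡ 1ℚ
n!*inv! n = trans (*-comm (ℕ→ℚ (n !)) (inv! n)) (inv!*n! n)

inv!-suc : ∀ n → ℕ→ℚ (suc n) * inv! (suc n) ≡ inv! n
inv!-suc n = inverse-unique (ℕ→ℚ (n !)) _ (inv! n) n!-inverse (n!*inv! n)
  where
  open ≡-Reasoning
  n!-inverse : ℕ→ℚ (n !) * (ℕ→ℚ (suc n) * inv! (suc n)) ≡ 1ℚ
  n!-inverse = begin
    ℕ→ℚ (n !) * (ℕ→ℚ (suc n) * inv! (suc n))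
      ≡⟨ solve 3 (λ a b c → a :* (b :* c) := (b :* a) :* c) refl (ℕ→ℚ (n !)) (ℕ→ℚ (suc n)) (inv! (suc n)) ⟩
    (ℕ→ℚ (suc n) * ℕ→ℚ (n !)) * inv! (suc n) ≡⟨ cong (_* inv! (suc n)) (sym (ℕ→ℚ-* (suc n) (n !))) ⟩
    ℕ→ℚ (suc n !) * inv! (suc n)             ≡⟨ n!*inv! (suc n) ⟩
    1ℚ                                        ∎

binomial-inv! : ∀ n k → k ℕ.≤ n → inv! k * inv! (n ∸ k) ≡ ℕ→ℚ (n C k) * inv! n
binomial-inv! n k k≤n = inverse-unique P _ _ P-inverse₁ P-inverse₂
  where
  open ≡-Reasoning
  P = ℕ→ℚ (k !) * ℕ→ℚ ((n ∸ k) !)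
  P-inverse₁ : P * (inv! k * inv! (n ∸ k)) ≡ 1ℚ
  P-inverse₁ = trans
    (solve 4 (λ a b c d → (a :* b) :* (c :* d) := (a :* c) :* (b :* d)) refl
       (ℕ→ℚ (k !)) (ℕ→ℚ ((n ∸ k) !)) (inv! k) (inv! (n ∸ k)))
    (cong₂ _*_ (n!*inv! k) (n!*inv! (n ∸ k)))
  factorial-formula : (n C k) ℕ.* (k ! ℕ.* (n ∸ k) !) ≡ n !
  factorial-formula = trans (cong (ℕ._* (k ! ℕ.* (n ∸ k) !)) (nCk≡n!/k![n-k]! k≤n))
                            (ℕD.m/n*n≡m {{k !* (n ∸ k) !≢0}} (k![n∸k]!∣n! k≤n))
  P-inverse₂ : P * (ℕ→ℚ (n C k) * inv! n) ≡ 1ℚ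
  P-inverse₂ = begin
    P * (ℕ→ℚ (n C k) * inv! n)
      ≡⟨ solve 3 (λ p c i → p :* (c :* i) := (c :* p) :* i) refl P (ℕ→ℚ (n C k)) (inv! n) ⟩
    (ℕ→ℚ (n C k) * P) * inv! n
      ≡⟨ cong (λ w → (ℕ→ℚ (n C k) * w) * inv! n) (sym (ℕ→ℚ-* (k !) ((n ∸ k) !))) ⟩
    (ℕ→ℚ (n C k) * ℕ→ℚ (k ! ℕ.* (n ∸ k) !)) * inv! n
      ≡⟨ cong (_* inv! n) (sym (ℕ→ℚ-* (n C k) (k ! ℕ.* (n ∸ k) !))) ⟩
    ℕ→ℚ ((n C k) ℕ.* (k ! ℕ.* (n ∸ k) !)) * inv! n ≡⟨ cong (λ w → ℕ→ℚ w * inv! n) factorial-formula ⟩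
    ℕ→ℚ (n !) * inv! n                              ≡⟨ n!*inv! n ⟩
    1ℚ                                              ∎

^-+ : ∀ x m n → x ^ℚ (m ℕ.+ n) ≡ x ^ℚ m * x ^ℚ n
^-+ x zero n = sym (*-identityˡ (x ^ℚ n))
^-+ x (suc m) n = trans (cong (x *_) (^-+ x m n)) (sym (*-assoc x (x ^ℚ m) (x ^ℚ n)))

^-distrib-* : ∀ x y n → (x * y) ^ℚ n ≡ x ^ℚ n * y ^ℚ n
^-distrib-* x y zero = refl
^-distrib-* x y (suc n) = trans (cong ((x * y) *_) (^-distrib-* x y n))
  (solve 4 (λ x y a b → (x :* y) :* (a :* b) := (x :* a) :* (y :* b)) refl x y (x ^ℚ n) (y ^ℚ n))

1^n≡1 : ∀ n → 1ℚ ^ℚ n ≡ 1ℚ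
1^n≡1 zero = refl
1^n≡1 (suc n) = trans (*-identityˡ (1ℚ ^ℚ n)) (1^n≡1 n)

^-* : ∀ x m n → x ^ℚ (m ℕ.* n) ≡ (x ^ℚ m) ^ℚ n
^-* x m zero = cong (x ^ℚ_) (ℕP.*-zeroʳ m)
^-* x m (suc n) = begin
  x ^ℚ (m ℕ.* suc n)       ≡⟨ cong (x ^ℚ_) (ℕP.*-suc m n) ⟩
  x ^ℚ (m ℕ.+ m ℕ.* n)     ≡⟨ ^-+ x m (m ℕ.* n) ⟩
  x ^ℚ m * x ^ℚ (m ℕ.* n)  ≡⟨ cong (x ^ℚ m *_) (^-* x m n) ⟩
  x ^ℚ m * (x ^ℚ m) ^ℚ n   ∎
  where open ≡-Reasoning

reciprocal-scale : ∀ a b x y → x * y ≡ 1ℚ → (a * x) * (b * y) ≡ a * b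
reciprocal-scale a b x y xy≡1 = trans
  (solve 4 (λ a b x y → (a :* x) :* (b :* y) := (a :* b) :* (x :* y)) refl a b x y)
  (trans (cong ((a * b) *_) xy≡1) (*-identityʳ (a * b)))

two four : ℚ
two = ℕ→ℚ 2
four = ℕ→ℚ 4

2*½ : ∀ x → two * (½ * x) ≡ x
2*½ x = solve 1 (λ x → con two :* (con ½ :* x) := x) refl x

inv2^*2^ : ∀ m → inv2^ m * two ^ℚ m ≡ 1ℚ
inv2^*2^ m = trans (cong (inv2^ m *_) (sym (ℕ→ℚ-^ 2 m))) (1/n*n≡1 (2 ℕ.^ m) {{ℕP.m^n≢0 2 m}})

inv2^-+ : ∀ m n → inv2^ (m ℕ.+ n) ≡ inv2^ m * inv2^ n
inv2^-+ m n = inverse-unique (two ^ℚ (m ℕ.+ n)) _ _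
  (trans (*-comm (two ^ℚ (m ℕ.+ n)) (inv2^ (m ℕ.+ n))) (inv2^*2^ (m ℕ.+ n))) product-inverse
  where
  open ≡-Reasoning
  product-inverse : two ^ℚ (m ℕ.+ n) * (inv2^ m * inv2^ n) ≡ 1ℚ
  product-inverse = begin
    two ^ℚ (m ℕ.+ n) * (inv2^ m * inv2^ n)       ≡⟨ cong (_* (inv2^ m * inv2^ n)) (^-+ two m n) ⟩
    (two ^ℚ m * two ^ℚ n) * (inv2^ m * inv2^ n)
      ≡⟨ solve 4 (λ a b c d → (a :* b) :* (c :* d) := (c :* a) :* (d :* b)) refl (two ^ℚ m) (two ^ℚ n) (inv2^ m) (inv2^ n) ⟩
    (inv2^ m * two ^ℚ m) * (inv2^ n * two ^ℚ n)  ≡⟨ cong₂ _*_ (inv2^*2^ m) (inv2^*2^ n) ⟩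
    1ℚ                                            ∎

inv2^≡½^ : ∀ m → inv2^ m ≡ ½ ^ℚ m
inv2^≡½^ m = inverse-unique (two ^ℚ m) _ _
  (trans (*-comm (two ^ℚ m) (inv2^ m)) (inv2^*2^ m))
  (trans (sym (^-distrib-* two ½ m)) (1^n≡1 m))

sumTo-cong≤ : ∀ n {f g : ℕ → ℚ} → (∀ k → k ℕ.≤ n → f k ≡ g k) → sumTo n f ≡ sumTo n g
sumTo-cong≤ zero f≡g = f≡g 0 z≤n
sumTo-cong≤ (suc n) f≡g =
  cong₂ _+_ (sumTo-cong≤ n (λ k k≤n → f≡g k (ℕP.m≤n⇒m≤1+n k≤n))) (f≡g (suc n) ℕP.≤-refl)

sumTo-cong : ∀ n {f g : ℕ → ℚ} → (∀ k → f k ≡ g k) → sumTo n f ≡ sumTo n g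
sumTo-cong n f≡g = sumTo-cong≤ n (λ k _ → f≡g k)

sumTo-+ : ∀ n (f g : ℕ → ℚ) → sumTo n (λ k → f k + g k) ≡ sumTo n f + sumTo n g
sumTo-+ zero f g = refl
sumTo-+ (suc n) f g = trans (cong (_+ (f (suc n) + g (suc n))) (sumTo-+ n f g))
  (solve 4 (λ a b c d → (a :+ b) :+ (c :+ d) := (a :+ c) :+ (b :+ d)) refl
     (sumTo n f) (sumTo n g) (f (suc n)) (g (suc n)))

sumTo-*ˡ : ∀ n c (f : ℕ → ℚ) → c * sumTo n f ≡ sumTo n (λ k → c * f k)
sumTo-*ˡ zero c f = refl
sumTo-*ˡ (suc n) c f =
  trans (*-distribˡ-+ c (sumTo n f) (f (suc n))) (cong (_+ (c * f (suc n))) (sumTo-*ˡ n c f))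

sumTo-*ʳ : ∀ n c (f : ℕ → ℚ) → sumTo n f * c ≡ sumTo n (λ k → f k * c)
sumTo-*ʳ n c f = trans (*-comm (sumTo n f) c)
  (trans (sumTo-*ˡ n c f) (sumTo-cong n (λ k → *-comm c (f k))))

sumTo-neg : ∀ n (f : ℕ → ℚ) → - sumTo n f ≡ sumTo n (λ k → - f k)
sumTo-neg zero f = refl
sumTo-neg (suc n) f =
  trans (neg-distrib-+ (sumTo n f) (f (suc n))) (cong (_+ (- f (suc n))) (sumTo-neg n f))

sumTo-zero : ∀ n (f : ℕ → ℚ) → (∀ k → k ℕ.≤ n → f k ≡ 0ℚ) → sumTo n f ≡ 0ℚ
sumTo-zero n f f≡0 = trans (sumTo-cong≤ n f≡0) (constant-zero n)
  where
  constant-zero : ∀ n → sumTo n (λ _ → 0ℚ) ≡ 0ℚ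
  constant-zero zero = refl
  constant-zero (suc n) = trans (+-identityʳ (sumTo n (λ _ → 0ℚ))) (constant-zero n)

sumTo-sucˡ : ∀ n (f : ℕ → ℚ) → sumTo (suc n) f ≡ f 0 + sumTo n (λ k → f (suc k))
sumTo-sucˡ zero f = refl
sumTo-sucˡ (suc n) f = trans (cong (_+ f (suc (suc n))) (sumTo-sucˡ n f))
  (+-assoc (f 0) (sumTo n (λ k → f (suc k))) (f (suc (suc n))))

sumTo-reverse : ∀ n (f : ℕ → ℚ) → sumTo n f ≡ sumTo n (λ k → f (n ∸ k))
sumTo-reverse zero f = refl
sumTo-reverse (suc n) f = begin
  sumTo (suc n) f                                 ≡⟨ sumTo-sucˡ n f ⟩
  f 0 + sumTo n (λ k → f (suc k))                 ≡⟨ cong (λ w → f 0 + w) (sumTo-reverse n (λ k → f (suc k))) ⟩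
  f 0 + sumTo n (λ k → f (suc (n ∸ k)))
    ≡⟨ cong (λ w → f 0 + w) (sumTo-cong≤ n (λ k k≤n → cong f (sym (ℕP.+-∸-assoc 1 k≤n)))) ⟩
  f 0 + sumTo n (λ k → f (suc n ∸ k))             ≡⟨ +-comm (f 0) _ ⟩
  sumTo n (λ k → f (suc n ∸ k)) + f 0
    ≡⟨ cong (λ w → sumTo n (λ k → f (suc n ∸ k)) + f w) (sym (ℕP.n∸n≡0 (suc n))) ⟩
  sumTo (suc n) (λ k → f (suc n ∸ k))             ∎
  where open ≡-Reasoning

sumTo-triangle : ∀ n (F : ℕ → ℕ → ℚ) →
  sumTo n (λ k → sumTo k (λ i → F i k)) ≡ sumTo n (λ i → sumTo (n ∸ i) (λ j → F i (i ℕ.+ j)))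
sumTo-triangle zero F = refl
sumTo-triangle (suc n) F = begin
  sumTo n (λ k → sumTo k (λ i → F i k)) + sumTo (suc n) (λ i → F i (suc n))
    ≡⟨ cong (_+ sumTo (suc n) (λ i → F i (suc n))) (sumTo-triangle n F) ⟩
  A + (sumTo n (λ i → F i (suc n)) + F (suc n) (suc n))
    ≡⟨ sym (+-assoc A (sumTo n (λ i → F i (suc n))) (F (suc n) (suc n))) ⟩
  (A + sumTo n (λ i → F i (suc n))) + F (suc n) (suc n)
    ≡⟨ cong₂ _+_ (sym (sumTo-+ n _ _)) (cong (F (suc n)) (sym (ℕP.+-identityʳ (suc n)))) ⟩
  sumTo n (λ i → sumTo (n ∸ i) (λ j → F i (i ℕ.+ j)) + F i (suc n)) + F (suc n) (suc n ℕ.+ 0)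
    ≡⟨ cong₂ _+_ (sumTo-cong≤ n extend-row)
         (cong (λ w → sumTo w (λ j → F (suc n) (suc n ℕ.+ j))) (sym (ℕP.n∸n≡0 (suc n)))) ⟩
  sumTo (suc n) (λ i → sumTo (suc n ∸ i) (λ j → F i (i ℕ.+ j))) ∎
  where
  open ≡-Reasoning
  A = sumTo n (λ i → sumTo (n ∸ i) (λ j → F i (i ℕ.+ j)))
  -- row i of the new triangle gains the entry F i (n + 1)
  extend-row : ∀ i → i ℕ.≤ n →
    sumTo (n ∸ i) (λ j → F i (i ℕ.+ j)) + F i (suc n) ≡ sumTo (suc n ∸ i) (λ j → F i (i ℕ.+ j))
  extend-row i i≤n rewrite ℕP.+-∸-assoc 1 i≤n =
    cong (λ w → sumTo (n ∸ i) (λ j → F i (i ℕ.+ j)) + F i w)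
      (trans (cong suc (sym (ℕP.m+[n∸m]≡n i≤n))) (sym (ℕP.+-suc i (n ∸ i))))

-- Exponential generating functions: sequences ℕ → ℚ, compared
-- coefficientwise, multiplied by the Cauchy product.

Series : Set
Series = ℕ → ℚ

infix 4 _≋_
_≋_ : Series → Series → Set
a ≋ b = ∀ n → a n ≡ b n

infixl 7 _⊛_ _·_
infixl 6 _⊕_ _⊖_

_⊛_ : Series → Series → Series
(a ⊛ b) n = sumTo n (λ k → a k * b (n ∸ k))

_⊕_ _⊖_ : Series → Series → Series
(a ⊕ b) n = a n + b n
(a ⊖ b) n = a n - b n

_·_ : ℚ → Series → Series
(c · a) n = c * a n

-- a(x) ↦ a(qx)
dilate : ℚ → Series → Series
dilate q a n = q ^ℚ n * a n

𝟙 𝕩 : Series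
𝟙 zero = 1ℚ
𝟙 (suc n) = 0ℚ
𝕩 (suc zero) = 1ℚ
𝕩 _ = 0ℚ

-- exp q has coefficients qⁿ/n!, i.e. it is e^{qx}.
exp : ℚ → Series
exp x = dilate x inv!

e : Series
e = exp 1ℚ

e≡inv! : ∀ n → e n ≡ inv! n
e≡inv! n = trans (cong (_* inv! n) (1^n≡1 n)) (*-identityˡ (inv! n))

⊛-comm : ∀ a b → a ⊛ b ≋ b ⊛ a
⊛-comm a b n = trans (sumTo-reverse n (λ k → a k * b (n ∸ k)))
  (sumTo-cong≤ n (λ k k≤n →
    trans (cong (λ w → a (n ∸ k) * b w) (ℕP.m∸[m∸n]≡n k≤n)) (*-comm (a (n ∸ k)) (b k))))

⊛-assoc : ∀ a b c → (a ⊛ b) ⊛ c ≋ a ⊛ (b ⊛ c)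
⊛-assoc a b c n = begin
  sumTo n (λ k → sumTo k (λ i → a i * b (k ∸ i)) * c (n ∸ k))
    ≡⟨ sumTo-cong n (λ k → sumTo-*ʳ k (c (n ∸ k)) (λ i → a i * b (k ∸ i))) ⟩
  sumTo n (λ k → sumTo k (λ i → a i * b (k ∸ i) * c (n ∸ k)))
    ≡⟨ sumTo-triangle n (λ i k → a i * b (k ∸ i) * c (n ∸ k)) ⟩
  sumTo n (λ i → sumTo (n ∸ i) (λ j → a i * b (i ℕ.+ j ∸ i) * c (n ∸ (i ℕ.+ j))))
    ≡⟨ sumTo-cong n (λ i → sumTo-cong (n ∸ i) (λ j →
         trans (cong₂ (λ u v → a i * b u * c v) (ℕP.m+n∸m≡n i j) (sym (ℕP.∸-+-assoc n i j)))
               (*-assoc (a i) (b j) (c (n ∸ i ∸ j))))) ⟩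
  sumTo n (λ i → sumTo (n ∸ i) (λ j → a i * (b j * c (n ∸ i ∸ j))))
    ≡⟨ sumTo-cong n (λ i → sym (sumTo-*ˡ (n ∸ i) (a i) (λ j → b j * c (n ∸ i ∸ j)))) ⟩
  (a ⊛ (b ⊛ c)) n ∎
  where open ≡-Reasoning

⊛-congˡ : ∀ {a a′} b → a ≋ a′ → a ⊛ b ≋ a′ ⊛ b
⊛-congˡ b a≋a′ n = sumTo-cong n (λ k → cong (_* b (n ∸ k)) (a≋a′ k))

⊛-congʳ : ∀ a {b b′} → b ≋ b′ → a ⊛ b ≋ a ⊛ b′
⊛-congʳ a b≋b′ n = sumTo-cong n (λ k → cong (a k *_) (b≋b′ (n ∸ k)))

⊛-distribʳ-⊕ : ∀ a b c → (a ⊕ b) ⊛ c ≋ a ⊛ c ⊕ b ⊛ c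
⊛-distribʳ-⊕ a b c n = trans (sumTo-cong n (λ k → *-distribʳ-+ (c (n ∸ k)) (a k) (b k)))
  (sumTo-+ n (λ k → a k * c (n ∸ k)) (λ k → b k * c (n ∸ k)))

⊛-distribʳ-⊖ : ∀ a b c → (a ⊖ b) ⊛ c ≋ a ⊛ c ⊖ b ⊛ c
⊛-distribʳ-⊖ a b c n = begin
  sumTo n (λ k → (a k - b k) * c (n ∸ k))
    ≡⟨ sumTo-cong n (λ k → solve 3 (λ x y z → (x :- y) :* z := x :* z :+ :- (y :* z)) refl (a k) (b k) (c (n ∸ k))) ⟩
  sumTo n (λ k → a k * c (n ∸ k) + - (b k * c (n ∸ k)))
    ≡⟨ sumTo-+ n (λ k → a k * c (n ∸ k)) (λ k → - (b k * c (n ∸ k))) ⟩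
  (a ⊛ c) n + sumTo n (λ k → - (b k * c (n ∸ k)))
    ≡⟨ cong (λ w → (a ⊛ c) n + w) (sym (sumTo-neg n (λ k → b k * c (n ∸ k)))) ⟩
  (a ⊛ c) n - (b ⊛ c) n ∎
  where open ≡-Reasoning

⊛-distribˡ-⊕ : ∀ a b c → a ⊛ (b ⊕ c) ≋ a ⊛ b ⊕ a ⊛ c
⊛-distribˡ-⊕ a b c n = trans (⊛-comm a (b ⊕ c) n) (trans (⊛-distribʳ-⊕ b c a n)
  (cong₂ _+_ (⊛-comm b a n) (⊛-comm c a n)))

⊛-distribˡ-⊖ : ∀ a b c → a ⊛ (b ⊖ c) ≋ a ⊛ b ⊖ a ⊛ c
⊛-distribˡ-⊖ a b c n = trans (⊛-comm a (b ⊖ c) n) (trans (⊛-distribʳ-⊖ b c a n)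
  (cong₂ _-_ (⊛-comm b a n) (⊛-comm c a n)))

·-⊛ : ∀ q a b → (q · a) ⊛ b ≋ q · (a ⊛ b)
·-⊛ q a b n = trans (sumTo-cong n (λ k → *-assoc q (a k) (b (n ∸ k))))
  (sym (sumTo-*ˡ n q (λ k → a k * b (n ∸ k))))

⊛-· : ∀ q a b → a ⊛ (q · b) ≋ q · (a ⊛ b)
⊛-· q a b n = trans (⊛-comm a (q · b) n) (trans (·-⊛ q b a n) (cong (q *_) (⊛-comm b a n)))

⊛-identityˡ : ∀ a → 𝟙 ⊛ a ≋ a
⊛-identityˡ a zero = *-identityˡ (a 0)
⊛-identityˡ a (suc n) = begin
  sumTo (suc n) (λ k → 𝟙 k * a (suc n ∸ k))           ≡⟨ sumTo-sucˡ n (λ k → 𝟙 k * a (suc n ∸ k)) ⟩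
  1ℚ * a (suc n) + sumTo n (λ k → 0ℚ * a (n ∸ k))
    ≡⟨ cong₂ _+_ (*-identityˡ (a (suc n))) (sumTo-zero n _ (λ k _ → *-zeroˡ (a (n ∸ k)))) ⟩
  a (suc n) + 0ℚ                                       ≡⟨ +-identityʳ (a (suc n)) ⟩
  a (suc n)                                            ∎
  where open ≡-Reasoning

⊛-identityʳ : ∀ a → a ⊛ 𝟙 ≋ a
⊛-identityʳ a n = trans (⊛-comm a 𝟙 n) (⊛-identityˡ a n)

dilate-⊛ : ∀ q a b → dilate q (a ⊛ b) ≋ dilate q a ⊛ dilate q b
dilate-⊛ q a b n = trans (sumTo-*ˡ n (q ^ℚ n) (λ k → a k * b (n ∸ k))) (sumTo-cong≤ n split-power)
  where
  split-power : ∀ k → k ℕ.≤ n → q ^ℚ n * (a k * b (n ∸ k)) ≡ q ^ℚ k * a k * (q ^ℚ (n ∸ k) * b (n ∸ k))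
  split-power k k≤n = begin
    q ^ℚ n * (a k * b (n ∸ k))
      ≡⟨ cong (λ w → q ^ℚ w * (a k * b (n ∸ k))) (sym (ℕP.m+[n∸m]≡n k≤n)) ⟩
    q ^ℚ (k ℕ.+ (n ∸ k)) * (a k * b (n ∸ k))
      ≡⟨ cong (_* (a k * b (n ∸ k))) (^-+ q k (n ∸ k)) ⟩
    q ^ℚ k * q ^ℚ (n ∸ k) * (a k * b (n ∸ k))
      ≡⟨ solve 4 (λ x y u v → x :* y :* (u :* v) := x :* u :* (y :* v)) refl (q ^ℚ k) (q ^ℚ (n ∸ k)) (a k) (b (n ∸ k)) ⟩
    q ^ℚ k * a k * (q ^ℚ (n ∸ k) * b (n ∸ k)) ∎
    where open ≡-Reasoning

dilate-⊖ : ∀ q a c → dilate q (a ⊖ c) ≋ dilate q a ⊖ dilate q c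
dilate-⊖ q a c n = solve 3 (λ p x y → p :* (x :- y) := p :* x :- p :* y) refl (q ^ℚ n) (a n) (c n)

dilate-𝟙 : ∀ q → dilate q 𝟙 ≋ 𝟙
dilate-𝟙 q zero = refl
dilate-𝟙 q (suc n) = *-zeroʳ (q ^ℚ suc n)

dilate-𝕩 : ∀ q → dilate q 𝕩 ≋ q · 𝕩
dilate-𝕩 q zero = trans (*-zeroʳ (q ^ℚ 0)) (sym (*-zeroʳ q))
dilate-𝕩 q (suc zero) = *-identityʳ (q * 1ℚ)
dilate-𝕩 q (suc (suc n)) = trans (*-zeroʳ (q ^ℚ suc (suc n))) (sym (*-zeroʳ q))

dilate-exp : ∀ q x → dilate q (exp x) ≋ exp (q * x)
dilate-exp q x n = trans (sym (*-assoc (q ^ℚ n) (x ^ℚ n) (inv! n))) (cong (_* inv! n) (sym (^-distrib-* q x n)))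

∂ : Series → Series
∂ a n = ℕ→ℚ (suc n) * a (suc n)

∂-⊛ : ∀ a b → ∂ (a ⊛ b) ≋ ∂ a ⊛ b ⊕ a ⊛ ∂ b
∂-⊛ a b n = begin
  N * sumTo (suc n) (λ k → a k * b (suc n ∸ k))
    ≡⟨ sumTo-*ˡ (suc n) N (λ k → a k * b (suc n ∸ k)) ⟩
  sumTo (suc n) (λ k → N * (a k * b (suc n ∸ k)))
    ≡⟨ sumTo-cong≤ (suc n) split-weight ⟩
  sumTo (suc n) (λ k → ℕ→ℚ k * a k * b (suc n ∸ k) + a k * (ℕ→ℚ (suc n ∸ k) * b (suc n ∸ k)))
    ≡⟨ sumTo-+ (suc n) (λ k → ℕ→ℚ k * a k * b (suc n ∸ k)) (λ k → a k * (ℕ→ℚ (suc n ∸ k) * b (suc n ∸ k))) ⟩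
  sumTo (suc n) (λ k → ℕ→ℚ k * a k * b (suc n ∸ k)) + sumTo (suc n) (λ k → a k * (ℕ→ℚ (suc n ∸ k) * b (suc n ∸ k)))
    ≡⟨ cong₂ _+_ left-factor right-factor ⟩
  (∂ a ⊛ b) n + (a ⊛ ∂ b) n ∎
  where
  open ≡-Reasoning
  N = ℕ→ℚ (suc n)
  -- n + 1 = k + (n + 1 − k)
  split-weight : ∀ k → k ℕ.≤ suc n →
    N * (a k * b (suc n ∸ k)) ≡ ℕ→ℚ k * a k * b (suc n ∸ k) + a k * (ℕ→ℚ (suc n ∸ k) * b (suc n ∸ k))
  split-weight k k≤ = begin
    N * (a k * b (suc n ∸ k))
      ≡⟨ cong (λ w → ℕ→ℚ w * (a k * b (suc n ∸ k))) (sym (ℕP.m+[n∸m]≡n k≤)) ⟩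
    ℕ→ℚ (k ℕ.+ (suc n ∸ k)) * (a k * b (suc n ∸ k))
      ≡⟨ cong (_* (a k * b (suc n ∸ k))) (ℕ→ℚ-+ k (suc n ∸ k)) ⟩
    (ℕ→ℚ k + ℕ→ℚ (suc n ∸ k)) * (a k * b (suc n ∸ k))
      ≡⟨ solve 4 (λ p q x y → (p :+ q) :* (x :* y) := p :* x :* y :+ x :* (q :* y)) refl
           (ℕ→ℚ k) (ℕ→ℚ (suc n ∸ k)) (a k) (b (suc n ∸ k)) ⟩
    ℕ→ℚ k * a k * b (suc n ∸ k) + a k * (ℕ→ℚ (suc n ∸ k) * b (suc n ∸ k)) ∎
  -- the k = 0 term vanishes
  left-factor : sumTo (suc n) (λ k → ℕ→ℚ k * a k * b (suc n ∸ k)) ≡ (∂ a ⊛ b) n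
  left-factor = begin
    sumTo (suc n) (λ k → ℕ→ℚ k * a k * b (suc n ∸ k))
      ≡⟨ sumTo-sucˡ n (λ k → ℕ→ℚ k * a k * b (suc n ∸ k)) ⟩
    0ℚ * a 0 * b (suc n) + (∂ a ⊛ b) n
      ≡⟨ cong (_+ (∂ a ⊛ b) n) (trans (cong (_* b (suc n)) (*-zeroˡ (a 0))) (*-zeroˡ (b (suc n)))) ⟩
    0ℚ + (∂ a ⊛ b) n ≡⟨ +-identityˡ ((∂ a ⊛ b) n) ⟩
    (∂ a ⊛ b) n ∎
  -- the k = n + 1 term vanishes
  right-factor : sumTo (suc n) (λ k → a k * (ℕ→ℚ (suc n ∸ k) * b (suc n ∸ k))) ≡ (a ⊛ ∂ b) n
  right-factor = begin
    sumTo n (λ k → a k * (ℕ→ℚ (suc n ∸ k) * b (suc n ∸ k))) + a (suc n) * (ℕ→ℚ (suc n ∸ suc n) * b (suc n ∸ suc n))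
      ≡⟨ cong₂ _+_ (sumTo-cong≤ n (λ k k≤ → cong (λ w → a k * (ℕ→ℚ w * b w)) (ℕP.+-∸-assoc 1 k≤)))
                   (cong (λ w → a (suc n) * (ℕ→ℚ w * b w)) (ℕP.n∸n≡0 n)) ⟩
    (a ⊛ ∂ b) n + a (suc n) * (0ℚ * b 0)
      ≡⟨ cong (λ w → (a ⊛ ∂ b) n + w) (trans (cong (a (suc n) *_) (*-zeroˡ (b 0))) (*-zeroʳ (a (suc n)))) ⟩
    (a ⊛ ∂ b) n + 0ℚ ≡⟨ +-identityʳ ((a ⊛ ∂ b) n) ⟩
    (a ⊛ ∂ b) n ∎

∂-unique : ∀ c f g → ∂ f ≋ c · f → ∂ g ≋ c · g → f 0 ≡ g 0 → f ≋ g
∂-unique c f g ∂f ∂g f₀≡g₀ zero = f₀≡g₀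
∂-unique c f g ∂f ∂g f₀≡g₀ (suc n) =
  cancel-invertible (ℕ→ℚ (suc n)) (+ 1 / suc n) (f (suc n)) (g (suc n)) (1/n*n≡1 (suc n))
    (trans (∂f n) (trans (cong (c *_) (∂-unique c f g ∂f ∂g f₀≡g₀ n)) (sym (∂g n))))

∂-exp : ∀ q → ∂ (exp q) ≋ q · exp q
∂-exp q n = begin
  ℕ→ℚ (suc n) * (q * q ^ℚ n * inv! (suc n))
    ≡⟨ solve 4 (λ N q P i → N :* (q :* P :* i) := q :* (P :* (N :* i))) refl (ℕ→ℚ (suc n)) q (q ^ℚ n) (inv! (suc n)) ⟩
  q * (q ^ℚ n * (ℕ→ℚ (suc n) * inv! (suc n))) ≡⟨ cong (λ w → q * (q ^ℚ n * w)) (inv!-suc n) ⟩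
  q * (q ^ℚ n * inv! n) ∎
  where open ≡-Reasoning

-- e^{px} e^{qx} = e^{(p+q)x}: both sides solve f′ = (p + q) f with f(0) = 1.
exp-+ : ∀ p q → exp p ⊛ exp q ≋ exp (p + q)
exp-+ p q = ∂-unique (p + q) (exp p ⊛ exp q) (exp (p + q)) ∂-product (∂-exp (p + q)) refl
  where
  ∂-product : ∂ (exp p ⊛ exp q) ≋ (p + q) · (exp p ⊛ exp q)
  ∂-product n = begin
    ∂ (exp p ⊛ exp q) n                                   ≡⟨ ∂-⊛ (exp p) (exp q) n ⟩
    (∂ (exp p) ⊛ exp q) n + (exp p ⊛ ∂ (exp q)) n
      ≡⟨ cong₂ _+_ (⊛-congˡ (exp q) (∂-exp p) n) (⊛-congʳ (exp p) (∂-exp q) n) ⟩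
    ((p · exp p) ⊛ exp q) n + (exp p ⊛ (q · exp q)) n
      ≡⟨ cong₂ _+_ (·-⊛ p (exp p) (exp q) n) (⊛-· q (exp p) (exp q) n) ⟩
    p * (exp p ⊛ exp q) n + q * (exp p ⊛ exp q) n          ≡⟨ sym (*-distribʳ-+ ((exp p ⊛ exp q) n) p q) ⟩
    (p + q) * (exp p ⊛ exp q) n                           ∎
    where open ≡-Reasoning

exp-0 : exp 0ℚ ≋ 𝟙
exp-0 zero = refl
exp-0 (suc n) = trans (cong (_* inv! (suc n)) (*-zeroˡ (0ℚ ^ℚ n))) (*-zeroˡ (inv! (suc n)))

⊛-cancel-unit : ∀ u v → u ⊛ v ≋ 𝟙 → ∀ a c → a ⊛ u ≋ c ⊛ u → a ≋ c
⊛-cancel-unit u v uv≋𝟙 a c au≋cu n = begin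
  a n               ≡⟨ sym (undo a n) ⟩
  ((a ⊛ u) ⊛ v) n   ≡⟨ ⊛-congˡ v au≋cu n ⟩
  ((c ⊛ u) ⊛ v) n   ≡⟨ undo c n ⟩
  c n               ∎
  where
  open ≡-Reasoning
  undo : ∀ w → (w ⊛ u) ⊛ v ≋ w
  undo w m = trans (⊛-assoc w u v m) (trans (⊛-congʳ w uv≋𝟙 m) (⊛-identityʳ w m))

e-unit : e ⊛ exp (- 1ℚ) ≋ 𝟙
e-unit n = trans (exp-+ 1ℚ (- 1ℚ) n) (exp-0 n)

⊛-leading : ∀ d u → u 0 ≡ 0ℚ → ∀ n → (∀ k → k ℕ.< n → d k ≡ 0ℚ) → (d ⊛ u) (suc n) ≡ d n * u 1
⊛-leading d u u₀≡0 zero _ = begin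
  d 0 * u 1 + d 1 * u 0   ≡⟨ cong (λ w → d 0 * u 1 + w) (trans (cong (d 1 *_) u₀≡0) (*-zeroʳ (d 1))) ⟩
  d 0 * u 1 + 0ℚ          ≡⟨ +-identityʳ (d 0 * u 1) ⟩
  d 0 * u 1               ∎
  where open ≡-Reasoning
⊛-leading d u u₀≡0 (suc p) earlier = begin
  sumTo p f + f (suc p) + f (suc (suc p))
    ≡⟨ cong₂ (λ x y → x + f (suc p) + y) (sumTo-zero p f early-terms) last-term ⟩
  0ℚ + f (suc p) + 0ℚ   ≡⟨ solve 1 (λ x → con 0ℚ :+ x :+ con 0ℚ := x) refl (f (suc p)) ⟩
  f (suc p)             ≡⟨ cong (λ w → d (suc p) * u w) (ℕP.m+n∸n≡m 1 p) ⟩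
  d (suc p) * u 1       ∎
  where
  open ≡-Reasoning
  f : ℕ → ℚ
  f k = d k * u (suc (suc p) ∸ k)
  early-terms : ∀ k → k ℕ.≤ p → f k ≡ 0ℚ
  early-terms k k≤p = trans (cong (_* u (suc (suc p) ∸ k)) (earlier k (s≤s k≤p))) (*-zeroˡ (u (suc (suc p) ∸ k)))
  last-term : f (suc (suc p)) ≡ 0ℚ
  last-term = trans (cong (λ w → d (suc (suc p)) * u w) (ℕP.n∸n≡0 p))
    (trans (cong (d (suc (suc p)) *_) u₀≡0) (*-zeroʳ (d (suc (suc p)))))

⊛-cancel-shift : ∀ u w → u 0 ≡ 0ℚ → w * u 1 ≡ 1ℚ → ∀ a c → a ⊛ u ≋ c ⊛ u → a ≋ c
⊛-cancel-shift u w u₀≡0 w*u₁≡1 a c au≋cu n = begin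
  a n                  ≡⟨ solve 2 (λ x y → x := (x :- y) :+ y) refl (a n) (c n) ⟩
  (a ⊖ c) n + c n      ≡⟨ cong (_+ c n) (difference-vanishes n) ⟩
  0ℚ + c n             ≡⟨ +-identityˡ (c n) ⟩
  c n                  ∎
  where
  open ≡-Reasoning
  d = a ⊖ c
  d⊛u≡0 : ∀ m → (d ⊛ u) m ≡ 0ℚ
  d⊛u≡0 m = trans (⊛-distribʳ-⊖ a c u m) (trans (cong (_- (c ⊛ u) m) (au≋cu m)) (+-inverseʳ ((c ⊛ u) m)))
  next : ∀ n → (∀ k → k ℕ.< n → d k ≡ 0ℚ) → d n ≡ 0ℚ
  next n earlier = cancel-invertible (u 1) w (d n) 0ℚ w*u₁≡1 (begin
    u 1 * d n      ≡⟨ *-comm (u 1) (d n) ⟩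
    d n * u 1      ≡⟨ sym (⊛-leading d u u₀≡0 n earlier) ⟩
    (d ⊛ u) (suc n) ≡⟨ d⊛u≡0 (suc n) ⟩
    0ℚ             ≡⟨ sym (*-zeroʳ (u 1)) ⟩
    u 1 * 0ℚ       ∎)
  below : ∀ n k → k ℕ.< n → d k ≡ 0ℚ
  below (suc n) k (s≤s k≤n) with ℕP.m≤n⇒m<n∨m≡n k≤n
  ... | inj₁ k<n = below n k k<n
  ... | inj₂ refl = next k (below k)
  difference-vanishes : ∀ n → d n ≡ 0ℚ
  difference-vanishes n = next n (below n)

nth-++ˡ : ∀ (l r : List ℚ) k → k ℕ.< length l → nth (l ++ r) k ≡ nth l k
nth-++ˡ (x ∷ l) r zero _ = refl
nth-++ˡ (x ∷ l) r (suc k) (s≤s k<) = nth-++ˡ l r k k<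

nth-last : ∀ (l : List ℚ) y → nth (l ++ [ y ]) (length l) ≡ y
nth-last [] y = refl
nth-last (x ∷ l) y = nth-last l y

length-bernList : ∀ n → length (bernList n) ≡ suc n
length-bernList zero = refl
length-bernList (suc n) = trans (ListP.length-++ (bernList n))
  (trans (cong (ℕ._+ 1) (length-bernList n)) (ℕP.+-comm (suc n) 1))

nth-bernList : ∀ n k → k ℕ.≤ n → nth (bernList n) k ≡ B k
nth-bernList zero zero _ = refl
nth-bernList (suc n) k k≤ with ℕP.m≤n⇒m<n∨m≡n k≤
... | inj₁ (s≤s k≤n) = trans
  (nth-++ˡ (bernList n) _ k (subst (k ℕ.<_) (sym (length-bernList n)) (s≤s k≤n)))
  (nth-bernList n k k≤n)
... | inj₂ refl = refl

-- Σ_{k < m} φ k, in the shape produced by folding a list.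
sumBelow : ℕ → (ℕ → ℚ) → ℚ
sumBelow zero φ = 0ℚ
sumBelow (suc m) φ = φ 0 + sumBelow m (λ k → φ (suc k))

sumBelow-suc : ∀ n φ → sumBelow (suc n) φ ≡ sumTo n φ
sumBelow-suc zero φ = +-identityʳ (φ 0)
sumBelow-suc (suc n) φ =
  trans (cong (λ w → φ 0 + w) (sumBelow-suc n (λ k → φ (suc k)))) (sym (sumTo-sucˡ n φ))

foldr-zipWith : ∀ (h : ℕ → ℚ → ℚ) m (f : ℕ → ℕ) (l : List ℚ) (g : ℕ → ℚ) →
  m ℕ.≤ length l → (∀ k → k ℕ.< m → nth l k ≡ g k) →
  foldr _+_ 0ℚ (zipWith h (applyUpTo f m) l) ≡ sumBelow m (λ k → h (f k) (g k))
foldr-zipWith h zero f l g _ _ = refl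
foldr-zipWith h (suc m) f (x ∷ l) g (s≤s m≤) l≡g = cong₂ _+_ (cong (h (f 0)) (l≡g 0 (s≤s z≤n)))
  (foldr-zipWith h m (λ k → f (suc k)) l (λ k → g (suc k)) m≤ (λ k k< → l≡g (suc k) (s≤s k<)))

B-recurrence : ∀ n → B (suc n) ≡ - ((+ 1 / suc (suc n)) * sumTo n (λ k → ℕ→ℚ (suc (suc n) C k) * B k))
B-recurrence n = begin
  B (suc n)
    ≡⟨ cong (nth (bernList n ++ [ next ])) (sym (length-bernList n)) ⟩
  nth (bernList n ++ [ next ]) (length (bernList n))
    ≡⟨ nth-last (bernList n) next ⟩
  next
    ≡⟨ cong (λ w → - ((+ 1 / suc (suc n)) * w))
         (trans (foldr-zipWith (λ k b → ℕ→ℚ (suc (suc n) C k) * b) (suc n) (λ k → k) (bernList n) B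
                   (ℕP.≤-reflexive (sym (length-bernList n))) (λ k k< → nth-bernList n k (ℕP.≤-pred k<)))
                (sumBelow-suc n (λ k → ℕ→ℚ (suc (suc n) C k) * B k))) ⟩
  - ((+ 1 / suc (suc n)) * sumTo n (λ k → ℕ→ℚ (suc (suc n) C k) * B k)) ∎
  where
  open ≡-Reasoning
  next = bernNext (suc n) (bernList n)

-- The generating function β(x) = Σ B_n xⁿ/n! = x/(eˣ − 1).

β : Series
β n = B n * inv! n

β≡0⇒B≡0 : ∀ n → β n ≡ 0ℚ → B n ≡ 0ℚ
β≡0⇒B≡0 n βₙ≡0 = cancel-invertible (inv! n) (ℕ→ℚ (n !)) (B n) 0ℚ (n!*inv! n)
  (trans (*-comm (inv! n) (B n)) (trans βₙ≡0 (sym (*-zeroʳ (inv! n)))))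

-- the binomial coefficient of the last summand in the recurrence
C[n+2,n+1] : ∀ n → suc (suc n) C suc n ≡ suc (suc n)
C[n+2,n+1] n = trans (nCk≡nC[n∸k] (ℕP.n≤1+n (suc n)))
  (trans (cong (suc (suc n) C_) (ℕP.m+n∸n≡m 1 n)) (nC1≡n (suc (suc n))))

-- The recurrence says that (β ⊛ e)ₘ₊₁, without its last term, is the
-- coefficient of x in x.
β⊛e-truncated : ∀ m → sumTo m (λ k → β k * e (suc m ∸ k)) ≡ 𝕩 (suc m)
β⊛e-truncated zero = refl
β⊛e-truncated (suc n) = begin
  sumTo (suc n) (λ k → β k * e (M ∸ k))
    ≡⟨ sumTo-cong≤ (suc n) (λ k k≤ → binomial-form k (ℕP.m≤n⇒m≤1+n k≤)) ⟩
  sumTo (suc n) (λ k → inv! M * (ℕ→ℚ (M C k) * B k))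
    ≡⟨ sym (sumTo-*ˡ (suc n) (inv! M) (λ k → ℕ→ℚ (M C k) * B k)) ⟩
  inv! M * (S + ℕ→ℚ (M C suc n) * B (suc n))
    ≡⟨ cong₂ (λ c b → inv! M * (S + ℕ→ℚ c * b)) (C[n+2,n+1] n) (B-recurrence n) ⟩
  inv! M * (S + ℕ→ℚ M * - ((+ 1 / M) * S))
    ≡⟨ solve 4 (λ i x n r → i :* (x :+ n :* (:- (r :* x))) := i :* x :* (con 1ℚ :+ :- (r :* n))) refl
         (inv! M) S (ℕ→ℚ M) (+ 1 / M) ⟩
  inv! M * S * (1ℚ + - ((+ 1 / M) * ℕ→ℚ M))
    ≡⟨ cong (λ w → inv! M * S * (1ℚ + - w)) (1/n*n≡1 M) ⟩
  inv! M * S * (1ℚ + - 1ℚ)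
    ≡⟨ *-zeroʳ (inv! M * S) ⟩
  0ℚ ∎
  where
  open ≡-Reasoning
  M = suc (suc n)
  S = sumTo n (λ k → ℕ→ℚ (M C k) * B k)
  binomial-form : ∀ k → k ℕ.≤ M → β k * e (M ∸ k) ≡ inv! M * (ℕ→ℚ (M C k) * B k)
  binomial-form k k≤ = begin
    B k * inv! k * e (M ∸ k)      ≡⟨ cong (B k * inv! k *_) (e≡inv! (M ∸ k)) ⟩
    B k * inv! k * inv! (M ∸ k)   ≡⟨ *-assoc (B k) (inv! k) (inv! (M ∸ k)) ⟩
    B k * (inv! k * inv! (M ∸ k)) ≡⟨ cong (B k *_) (binomial-inv! M k k≤) ⟩
    B k * (ℕ→ℚ (M C k) * inv! M)
      ≡⟨ solve 3 (λ x c i → x :* (c :* i) := i :* (c :* x)) refl (B k) (ℕ→ℚ (M C k)) (inv! M) ⟩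
    inv! M * (ℕ→ℚ (M C k) * B k)  ∎

β⊛e : β ⊛ e ≋ β ⊕ 𝕩
β⊛e zero = refl
β⊛e (suc m) = begin
  sumTo m (λ k → β k * e (suc m ∸ k)) + β (suc m) * e (suc m ∸ suc m)
    ≡⟨ cong₂ _+_ (β⊛e-truncated m) (cong (λ w → β (suc m) * e w) (ℕP.n∸n≡0 m)) ⟩
  𝕩 (suc m) + β (suc m) * 1ℚ
    ≡⟨ solve 2 (λ i x → i :+ x :* con 1ℚ := x :+ i) refl (𝕩 (suc m)) (β (suc m)) ⟩
  β (suc m) + 𝕩 (suc m) ∎
  where open ≡-Reasoning

β-generating : β ⊛ (e ⊖ 𝟙) ≋ 𝕩
β-generating n = begin
  (β ⊛ (e ⊖ 𝟙)) n        ≡⟨ ⊛-distribˡ-⊖ β e 𝟙 n ⟩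
  (β ⊛ e) n - (β ⊛ 𝟙) n  ≡⟨ cong₂ _-_ (β⊛e n) (⊛-identityʳ β n) ⟩
  β n + 𝕩 n - β n        ≡⟨ solve 2 (λ x i → x :+ i :- x := i) refl (β n) (𝕩 n) ⟩
  𝕩 n                    ∎
  where open ≡-Reasoning

β-generating-dilated : ∀ q → dilate q β ⊛ (exp (q * 1ℚ) ⊖ 𝟙) ≋ q · 𝕩
β-generating-dilated q n = begin
  (dilate q β ⊛ (exp (q * 1ℚ) ⊖ 𝟙)) n   ≡⟨ sym (⊛-congʳ (dilate q β) dilate-e⊖𝟙 n) ⟩
  (dilate q β ⊛ dilate q (e ⊖ 𝟙)) n     ≡⟨ sym (dilate-⊛ q β (e ⊖ 𝟙) n) ⟩
  dilate q (β ⊛ (e ⊖ 𝟙)) n              ≡⟨ cong (q ^ℚ n *_) (β-generating n) ⟩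
  dilate q 𝕩 n                          ≡⟨ dilate-𝕩 q n ⟩
  (q · 𝕩) n                             ∎
  where
  open ≡-Reasoning
  dilate-e⊖𝟙 : dilate q (e ⊖ 𝟙) ≋ exp (q * 1ℚ) ⊖ 𝟙
  dilate-e⊖𝟙 m = trans (dilate-⊖ q e 𝟙 m) (cong₂ _-_ (dilate-exp q 1ℚ m) (dilate-𝟙 q m))

-- β(−x) = β(x) + x: both sides times (e^{−x} − 1) give −x.
β-reflection : dilate (- 1ℚ) β ≋ β ⊕ 𝕩
β-reflection = ⊛-cancel-shift u (- 1ℚ) refl refl (dilate (- 1ℚ) β) (β ⊕ 𝕩)
  (λ n → trans (β-generating-dilated (- 1ℚ) n) (sym (shifted n)))
  where
  u = exp (- 1ℚ) ⊖ 𝟙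
  u⊛e : u ⊛ e ≋ 𝟙 ⊖ e
  u⊛e n = trans (⊛-distribʳ-⊖ (exp (- 1ℚ)) 𝟙 e n)
    (cong₂ _-_ (trans (⊛-comm (exp (- 1ℚ)) e n) (e-unit n)) (⊛-identityˡ e n))
  shifted : (β ⊕ 𝕩) ⊛ u ≋ (- 1ℚ) · 𝕩
  shifted = ⊛-cancel-unit e (exp (- 1ℚ)) e-unit ((β ⊕ 𝕩) ⊛ u) ((- 1ℚ) · 𝕩) times-e
    where
    times-e : ∀ n → (((β ⊕ 𝕩) ⊛ u) ⊛ e) n ≡ (((- 1ℚ) · 𝕩) ⊛ e) n
    times-e n = begin
      (((β ⊕ 𝕩) ⊛ u) ⊛ e) n           ≡⟨ ⊛-assoc (β ⊕ 𝕩) u e n ⟩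
      ((β ⊕ 𝕩) ⊛ (u ⊛ e)) n           ≡⟨ ⊛-congʳ (β ⊕ 𝕩) u⊛e n ⟩
      ((β ⊕ 𝕩) ⊛ (𝟙 ⊖ e)) n           ≡⟨ ⊛-distribˡ-⊖ (β ⊕ 𝕩) 𝟙 e n ⟩
      ((β ⊕ 𝕩) ⊛ 𝟙) n - ((β ⊕ 𝕩) ⊛ e) n
        ≡⟨ cong₂ _-_ (⊛-identityʳ (β ⊕ 𝕩) n) (⊛-distribʳ-⊕ β 𝕩 e n) ⟩
      (β n + 𝕩 n) - ((β ⊛ e) n + (𝕩 ⊛ e) n)  ≡⟨ cong (λ w → (β n + 𝕩 n) - (w + (𝕩 ⊛ e) n)) (β⊛e n) ⟩
      (β n + 𝕩 n) - ((β n + 𝕩 n) + (𝕩 ⊛ e) n)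
        ≡⟨ solve 2 (λ a c → a :- (a :+ c) := con (- 1ℚ) :* c) refl (β n + 𝕩 n) ((𝕩 ⊛ e) n) ⟩
      - 1ℚ * (𝕩 ⊛ e) n                       ≡⟨ sym (·-⊛ (- 1ℚ) 𝕩 e n) ⟩
      (((- 1ℚ) · 𝕩) ⊛ e) n                   ∎
      where open ≡-Reasoning

B-odd : ∀ m → B (suc (2 ℕ.* suc m)) ≡ 0ℚ
B-odd m = β≡0⇒B≡0 n (begin
  β n                                  ≡⟨ solve 1 (λ x → x := con ½ :* ((x :+ con 0ℚ) :- (con (- 1ℚ) :* con 1ℚ :* x))) refl (β n) ⟩
  ½ * ((β n + 0ℚ) - (- 1ℚ * 1ℚ * β n))  ≡⟨ cong (λ w → ½ * ((β n + 0ℚ) - (- 1ℚ * w * β n))) (sym even-power) ⟩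
  ½ * ((β n + 0ℚ) - dilate (- 1ℚ) β n)  ≡⟨ cong (λ w → ½ * ((β n + 0ℚ) - w)) (β-reflection n) ⟩
  ½ * ((β n + 0ℚ) - (β n + 0ℚ))         ≡⟨ solve 1 (λ y → con ½ :* (y :- y) := con 0ℚ) refl (β n + 0ℚ) ⟩
  0ℚ                                   ∎)
  where
  open ≡-Reasoning
  n = suc (2 ℕ.* suc m)
  even-power : (- 1ℚ) ^ℚ (2 ℕ.* suc m) ≡ 1ℚ
  even-power = trans (^-* (- 1ℚ) 2 (suc m)) (1^n≡1 (suc m))

β₂ : Series
β₂ = dilate two β

-- Duplication: β(2x)(eˣ + 1) = 2β(x); both sides times (eˣ − 1) give 2x.
β-duplication : β₂ ⊛ e ⊕ β₂ ≋ two · β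
β-duplication = ⊛-cancel-shift (e ⊖ 𝟙) 1ℚ refl refl _ (two · β)
  (λ n → trans (lhs n) (sym (rhs n)))
  where
  difference-of-squares : (e ⊕ 𝟙) ⊛ (e ⊖ 𝟙) ≋ exp (two * 1ℚ) ⊖ 𝟙
  difference-of-squares n = begin
    ((e ⊕ 𝟙) ⊛ (e ⊖ 𝟙)) n                ≡⟨ ⊛-distribʳ-⊕ e 𝟙 (e ⊖ 𝟙) n ⟩
    (e ⊛ (e ⊖ 𝟙)) n + (𝟙 ⊛ (e ⊖ 𝟙)) n    ≡⟨ cong₂ _+_ (⊛-distribˡ-⊖ e e 𝟙 n) (⊛-identityˡ (e ⊖ 𝟙) n) ⟩
    ((e ⊛ e) n - (e ⊛ 𝟙) n) + (e n - 𝟙 n) ≡⟨ cong₂ (λ x y → (x - y) + (e n - 𝟙 n)) (exp-+ 1ℚ 1ℚ n) (⊛-identityʳ e n) ⟩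
    (exp (1ℚ + 1ℚ) n - e n) + (e n - 𝟙 n)
      ≡⟨ solve 3 (λ x y z → (x :- y) :+ (y :- z) := x :- z) refl (exp (1ℚ + 1ℚ) n) (e n) (𝟙 n) ⟩
    exp (two * 1ℚ) n - 𝟙 n                ∎
    where open ≡-Reasoning
  lhs : ∀ n → ((β₂ ⊛ e ⊕ β₂) ⊛ (e ⊖ 𝟙)) n ≡ (two · 𝕩) n
  lhs n = begin
    ((β₂ ⊛ e ⊕ β₂) ⊛ (e ⊖ 𝟙)) n
      ≡⟨ ⊛-congˡ (e ⊖ 𝟙) (λ m → trans (cong (λ w → (β₂ ⊛ e) m + w) (sym (⊛-identityʳ β₂ m)))
                                       (sym (⊛-distribˡ-⊕ β₂ e 𝟙 m))) n ⟩
    ((β₂ ⊛ (e ⊕ 𝟙)) ⊛ (e ⊖ 𝟙)) n    ≡⟨ ⊛-assoc β₂ (e ⊕ 𝟙) (e ⊖ 𝟙) n ⟩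
    (β₂ ⊛ ((e ⊕ 𝟙) ⊛ (e ⊖ 𝟙))) n    ≡⟨ ⊛-congʳ β₂ difference-of-squares n ⟩
    (β₂ ⊛ (exp (two * 1ℚ) ⊖ 𝟙)) n    ≡⟨ β-generating-dilated two n ⟩
    (two · 𝕩) n                      ∎
    where open ≡-Reasoning
  rhs : ∀ n → ((two · β) ⊛ (e ⊖ 𝟙)) n ≡ (two · 𝕩) n
  rhs n = trans (·-⊛ two β (e ⊖ 𝟙) n) (cong (two *_) (β-generating n))

-- The coefficient of x^{u+2} in the duplication formula, with the last
-- two terms of the Cauchy product written out.
duplication-coefficient : ∀ u →
  sumTo u (λ k → β₂ k * e (suc (suc u) ∸ k)) + β₂ (suc u) + β₂ (suc (suc u)) + β₂ (suc (suc u))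
    ≡ two * β (suc (suc u))
duplication-coefficient u = begin
  Σ′ + β₂ (suc u) + β₂ (suc (suc u)) + β₂ (suc (suc u))
    ≡⟨ cong₂ (λ a b → Σ′ + a + b + β₂ (suc (suc u)))
         (sym (trans (cong (λ w → β₂ (suc u) * e w) (ℕP.m+n∸n≡m 1 u)) (*-identityʳ (β₂ (suc u)))))
         (sym (trans (cong (λ w → β₂ (suc (suc u)) * e w) (ℕP.n∸n≡0 u)) (*-identityʳ (β₂ (suc (suc u)))))) ⟩
  (β₂ ⊛ e ⊕ β₂) (suc (suc u)) ≡⟨ β-duplication (suc (suc u)) ⟩
  two * β (suc (suc u))       ∎
  where
  open ≡-Reasoning
  Σ′ = sumTo u (λ k → β₂ k * e (suc (suc u) ∸ k))

inv2^-∸ : ∀ s k → k ℕ.≤ s → inv2^ (s ∸ k) ≡ inv2^ s * two ^ℚ k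
inv2^-∸ s k k≤ = sym (begin
  inv2^ s * two ^ℚ k                  ≡⟨ cong (λ w → inv2^ w * two ^ℚ k) (sym (ℕP.m∸n+n≡m k≤)) ⟩
  inv2^ (s ∸ k ℕ.+ k) * two ^ℚ k      ≡⟨ cong (_* two ^ℚ k) (inv2^-+ (s ∸ k) k) ⟩
  inv2^ (s ∸ k) * inv2^ k * two ^ℚ k  ≡⟨ *-assoc (inv2^ (s ∸ k)) (inv2^ k) (two ^ℚ k) ⟩
  inv2^ (s ∸ k) * (inv2^ k * two ^ℚ k) ≡⟨ cong (inv2^ (s ∸ k) *_) (inv2^*2^ k) ⟩
  inv2^ (s ∸ k) * 1ℚ                  ≡⟨ *-identityʳ (inv2^ (s ∸ k)) ⟩
  inv2^ (s ∸ k)                       ∎)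
  where open ≡-Reasoning

B*-as-truncated-product : ∀ t → let s = suc (suc t) in
  B* s * inv! s ≡ - (inv2^ s * sumTo (suc t) (λ k → β₂ k * e (suc s ∸ k)))
B*-as-truncated-product t = begin
  - (r * Σ) * inv! s      ≡⟨ solve 3 (λ r Σ i → :- (r :* Σ) :* i := :- ((r :* i) :* Σ)) refl r Σ (inv! s) ⟩
  - ((r * inv! s) * Σ)    ≡⟨ cong (λ w → - (w * Σ)) r*inv!s ⟩
  - (inv! S1 * Σ)         ≡⟨ cong -_ (sumTo-*ˡ (suc t) (inv! S1) f) ⟩
  - sumTo (suc t) (λ k → inv! S1 * f k)
    ≡⟨ cong -_ (sumTo-cong≤ (suc t) term) ⟩
  - sumTo (suc t) (λ k → inv2^ s * (β₂ k * e (S1 ∸ k)))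
    ≡⟨ cong -_ (sym (sumTo-*ˡ (suc t) (inv2^ s) (λ k → β₂ k * e (S1 ∸ k)))) ⟩
  - (inv2^ s * sumTo (suc t) (λ k → β₂ k * e (S1 ∸ k))) ∎
  where
  open ≡-Reasoning
  s = suc (suc t)
  S1 = suc s
  r = + 1 / S1
  f : ℕ → ℚ
  f k = ℕ→ℚ (S1 C k) * inv2^ (s ∸ k) * B k
  Σ = sumTo (suc t) f
  r*inv!s : r * inv! s ≡ inv! S1
  r*inv!s = begin
    r * inv! s                 ≡⟨ cong (r *_) (sym (inv!-suc s)) ⟩
    r * (ℕ→ℚ S1 * inv! S1)     ≡⟨ sym (*-assoc r (ℕ→ℚ S1) (inv! S1)) ⟩
    r * ℕ→ℚ S1 * inv! S1       ≡⟨ cong (_* inv! S1) (1/n*n≡1 S1) ⟩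
    1ℚ * inv! S1               ≡⟨ *-identityˡ (inv! S1) ⟩
    inv! S1                    ∎
  term : ∀ k → k ℕ.≤ suc t → inv! S1 * f k ≡ inv2^ s * (β₂ k * e (S1 ∸ k))
  term k k≤ = begin
    inv! S1 * (ℕ→ℚ (S1 C k) * inv2^ (s ∸ k) * B k)
      ≡⟨ cong (λ w → inv! S1 * (ℕ→ℚ (S1 C k) * w * B k)) (inv2^-∸ s k k≤s) ⟩
    inv! S1 * (ℕ→ℚ (S1 C k) * (inv2^ s * two ^ℚ k) * B k)
      ≡⟨ solve 5 (λ i c p q z → i :* (c :* (p :* q) :* z) := p :* q :* z :* (c :* i)) refl
           (inv! S1) (ℕ→ℚ (S1 C k)) (inv2^ s) (two ^ℚ k) (B k) ⟩
    inv2^ s * two ^ℚ k * B k * (ℕ→ℚ (S1 C k) * inv! S1)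
      ≡⟨ cong (inv2^ s * two ^ℚ k * B k *_) (sym (binomial-inv! S1 k (ℕP.m≤n⇒m≤1+n k≤s))) ⟩
    inv2^ s * two ^ℚ k * B k * (inv! k * inv! (S1 ∸ k))
      ≡⟨ solve 5 (λ p q z i j → p :* q :* z :* (i :* j) := p :* (q :* (z :* i) :* j)) refl
           (inv2^ s) (two ^ℚ k) (B k) (inv! k) (inv! (S1 ∸ k)) ⟩
    inv2^ s * (β₂ k * inv! (S1 ∸ k))
      ≡⟨ cong (λ w → inv2^ s * (β₂ k * w)) (sym (e≡inv! (S1 ∸ k))) ⟩
    inv2^ s * (β₂ k * e (S1 ∸ k)) ∎
    where
    k≤s : k ℕ.≤ s
    k≤s = ℕP.m≤n⇒m≤1+n k≤

-- Solving the coefficient identity for the truncated sum Σ (with P = 2ˢ,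
-- x = β_s, y = β_{s+1}).
solve-truncated : ∀ iP P Σ x y → iP * P ≡ 1ℚ →
  Σ + P * x + two * P * y + two * P * y ≡ two * y → - (iP * Σ) ≡ x + (four - two * iP) * y
solve-truncated iP P Σ x y iP*P≡1 coefficient = begin
  - (iP * Σ)
    ≡⟨ solve 5 (λ iP P Σ x y → :- (iP :* Σ)
         := x :+ (con four :- con two :* iP) :* y :+ (iP :* P :- con 1ℚ) :* (x :+ con four :* y)
            :- iP :* ((Σ :+ P :* x :+ con two :* P :* y :+ con two :* P :* y) :- con two :* y)) refl iP P Σ x y ⟩
  x + (four - two * iP) * y + (iP * P - 1ℚ) * (x + four * y) - iP * (L - two * y)
    ≡⟨ cong₂ (λ a b → x + (four - two * iP) * y + (a - 1ℚ) * (x + four * y) - iP * (b - two * y))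
         iP*P≡1 coefficient ⟩
  x + (four - two * iP) * y + (1ℚ - 1ℚ) * (x + four * y) - iP * (two * y - two * y)
    ≡⟨ solve 4 (λ a b c d → a :+ (con 1ℚ :- con 1ℚ) :* b :- c :* (d :- d) := a) refl
         (x + (four - two * iP) * y) (x + four * y) iP (two * y) ⟩
  x + (four - two * iP) * y ∎
  where
  open ≡-Reasoning
  L = Σ + P * x + two * P * y + two * P * y

B*-formula : ∀ t → let s = suc (suc t) in
  B* s * inv! s ≡ β s + (four - two * inv2^ s) * β (suc s)
B*-formula t = trans (B*-as-truncated-product t)
  (solve-truncated (inv2^ s) (two ^ℚ s) _ (β s) (β (suc s)) (inv2^*2^ s) (duplication-coefficient (suc t)))
  where s = suc (suc t)

2*[1+m] : ∀ m → 2 ℕ.* suc m ≡ suc (suc (2 ℕ.* m))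
2*[1+m] m = ℕP.*-suc 2 m

β-odd : ∀ m → β (suc (suc (suc (2 ℕ.* m)))) ≡ 0ℚ
β-odd m = trans (cong (_* inv! n) (subst (λ w → B (suc w) ≡ 0ℚ) (2*[1+m] m) (B-odd m))) (*-zeroˡ (inv! n))
  where n = suc (suc (suc (2 ℕ.* m)))

B*-even : ∀ m → B* (2 ℕ.* m) ≡ B (2 ℕ.* m)
B*-even zero = refl
B*-even (suc m) = subst (λ w → B* w ≡ B w) (sym (2*[1+m] m))
  (cancel-invertible (inv! s) (ℕ→ℚ (s !)) (B* s) (B s) (n!*inv! s) (begin
    inv! s * B* s                       ≡⟨ *-comm (inv! s) (B* s) ⟩
    B* s * inv! s                       ≡⟨ B*-formula (2 ℕ.* m) ⟩
    β s + c * β (suc s)                 ≡⟨ cong (λ w → β s + c * w) (β-odd m) ⟩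
    β s + c * 0ℚ                        ≡⟨ solve 3 (λ b i c → b :* i :+ c :* con 0ℚ := i :* b) refl (B s) (inv! s) c ⟩
    inv! s * B s                        ∎))
  where
  open ≡-Reasoning
  s = suc (suc (2 ℕ.* m))
  c = four - two * inv2^ s

B*-odd : ∀ m → let o = suc (2 ℕ.* m) in B* o * inv! o ≡ (four - two * inv2^ o) * β (suc o)
B*-odd zero = refl
B*-odd (suc m) = subst (λ w → B* (suc w) * inv! (suc w) ≡ (four - two * inv2^ (suc w)) * β (suc (suc w)))
  (sym (2*[1+m] m)) (begin
    B* s * inv! s        ≡⟨ B*-formula (suc (2 ℕ.* m)) ⟩
    β s + c * β (suc s)  ≡⟨ cong (_+ c * β (suc s)) (β-odd m) ⟩
    0ℚ + c * β (suc s)   ≡⟨ +-identityˡ (c * β (suc s)) ⟩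
    c * β (suc s)        ∎)
  where
  open ≡-Reasoning
  s = suc (suc (suc (2 ℕ.* m)))
  c = four - two * inv2^ s

2s+2≡2[1+s] : ∀ s → 2 ℕ.* s ℕ.+ 2 ≡ 2 ℕ.* suc s
2s+2≡2[1+s] s = trans (ℕP.+-comm (2 ℕ.* s) 2) (sym (2*[1+m] s))

⌊[2s+2]/2⌋ : ∀ s → (2 ℕ.* s ℕ.+ 2) ℕ./ 2 ≡ suc s
⌊[2s+2]/2⌋ s = trans (cong (ℕ._/ 2) (trans (2s+2≡2[1+s] s) (ℕP.*-comm 2 (suc s)))) (ℕD.m*n/n≡m (suc s) 2)

⌊[2s+1]/2⌋ : ∀ s → suc (2 ℕ.* s) ℕ./ 2 ≡ s
⌊[2s+1]/2⌋ zero = refl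
⌊[2s+1]/2⌋ (suc s) = trans (cong (λ w → suc w ℕ./ 2) (2*[1+m] s))
  (trans (ℕD.m/n≡1+[m∸n]/n {suc (suc (suc (2 ℕ.* s)))} {2} (s≤s (s≤s z≤n))) (cong suc (⌊[2s+1]/2⌋ s)))

2k≤2s+2 : ∀ s k → k ℕ.≤ suc s → 2 ℕ.* k ℕ.≤ 2 ℕ.* s ℕ.+ 2
2k≤2s+2 s k k≤ = subst (2 ℕ.* k ℕ.≤_) (sym (2s+2≡2[1+s] s)) (ℕP.*-monoʳ-≤ 2 k≤)

2[1+s∸k] : ∀ s k → 2 ℕ.* (suc s ∸ k) ≡ (2 ℕ.* s ℕ.+ 2) ∸ 2 ℕ.* k
2[1+s∸k] s k = trans (ℕP.*-distribˡ-∸ 2 (suc s) k) (cong (_∸ 2 ℕ.* k) (sym (2s+2≡2[1+s] s)))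

[2s+1]∸2k : ∀ s k → k ℕ.≤ s → suc (2 ℕ.* s) ∸ 2 ℕ.* k ≡ suc (2 ℕ.* (s ∸ k))
[2s+1]∸2k s k k≤ = trans (ℕP.+-∸-assoc 1 (ℕP.*-monoʳ-≤ 2 k≤)) (cong suc (sym (ℕP.*-distribˡ-∸ 2 s k)))

[2s+2]∸2k : ∀ s k → k ℕ.≤ s → (2 ℕ.* s ℕ.+ 2) ∸ 2 ℕ.* k ≡ suc (suc (2 ℕ.* (s ∸ k)))
[2s+2]∸2k s k k≤ = trans (cong (_∸ 2 ℕ.* k) (ℕP.+-comm (2 ℕ.* s) 2))
  (trans (ℕP.+-∸-assoc 2 (ℕP.*-monoʳ-≤ 2 k≤)) (cong (λ w → suc (suc w)) (sym (ℕP.*-distribˡ-∸ 2 s k))))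

ρ : ℕ → ℚ → ℕ → ℚ
ρ s z k = B (2 ℕ.* k) * B (2 ℕ.* s ℕ.+ 2 ∸ 2 ℕ.* k)
    * inv! (2 ℕ.* k) * inv! (2 ℕ.* s ℕ.+ 2 ∸ 2 ℕ.* k) * z ^ℚ (2 ℕ.* k)

ρ≡β*β : ∀ s z k → ρ s z k ≡ β (2 ℕ.* k) * β (2 ℕ.* s ℕ.+ 2 ∸ 2 ℕ.* k) * z ^ℚ (2 ℕ.* k)
ρ≡β*β s z k = solve 5 (λ a b i j Z → a :* b :* i :* j :* Z := a :* i :* (b :* j) :* Z) refl
  (B (2 ℕ.* k)) (B (2 ℕ.* s ℕ.+ 2 ∸ 2 ℕ.* k)) (inv! (2 ℕ.* k)) (inv! (2 ℕ.* s ℕ.+ 2 ∸ 2 ℕ.* k)) (z ^ℚ (2 ℕ.* k))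

R-reciprocal : ∀ s x y → x * y ≡ 1ℚ → R s x ≡ x ^ℚ (2 ℕ.* s ℕ.+ 2) * R s y
R-reciprocal s x y xy≡1 = begin
  R s x                                      ≡⟨ sumTo-reverse (suc s) (ρ s x) ⟩
  sumTo (suc s) (λ k → ρ s x (suc s ∸ k))    ≡⟨ sumTo-cong≤ (suc s) reversed-term ⟩
  sumTo (suc s) (λ k → x ^ℚ M * ρ s y k)     ≡⟨ sym (sumTo-*ˡ (suc s) (x ^ℚ M) (ρ s y)) ⟩
  x ^ℚ M * R s y                             ∎
  where
  open ≡-Reasoning
  M = 2 ℕ.* s ℕ.+ 2
  complementary-power : ∀ k → k ℕ.≤ suc s → x ^ℚ (M ∸ 2 ℕ.* k) ≡ x ^ℚ M * y ^ℚ (2 ℕ.* k)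
  complementary-power k k≤ = sym (begin
    x ^ℚ M * y ^ℚ (2 ℕ.* k)
      ≡⟨ cong (λ w → x ^ℚ w * y ^ℚ (2 ℕ.* k)) (sym (ℕP.m∸n+n≡m (2k≤2s+2 s k k≤))) ⟩
    x ^ℚ (M ∸ 2 ℕ.* k ℕ.+ 2 ℕ.* k) * y ^ℚ (2 ℕ.* k)
      ≡⟨ cong (_* y ^ℚ (2 ℕ.* k)) (^-+ x (M ∸ 2 ℕ.* k) (2 ℕ.* k)) ⟩
    x ^ℚ (M ∸ 2 ℕ.* k) * x ^ℚ (2 ℕ.* k) * y ^ℚ (2 ℕ.* k)
      ≡⟨ *-assoc (x ^ℚ (M ∸ 2 ℕ.* k)) (x ^ℚ (2 ℕ.* k)) (y ^ℚ (2 ℕ.* k)) ⟩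
    x ^ℚ (M ∸ 2 ℕ.* k) * (x ^ℚ (2 ℕ.* k) * y ^ℚ (2 ℕ.* k))
      ≡⟨ cong (x ^ℚ (M ∸ 2 ℕ.* k) *_) (sym (^-distrib-* x y (2 ℕ.* k))) ⟩
    x ^ℚ (M ∸ 2 ℕ.* k) * (x * y) ^ℚ (2 ℕ.* k)
      ≡⟨ cong (λ w → x ^ℚ (M ∸ 2 ℕ.* k) * w ^ℚ (2 ℕ.* k)) xy≡1 ⟩
    x ^ℚ (M ∸ 2 ℕ.* k) * 1ℚ ^ℚ (2 ℕ.* k)
      ≡⟨ cong (x ^ℚ (M ∸ 2 ℕ.* k) *_) (1^n≡1 (2 ℕ.* k)) ⟩
    x ^ℚ (M ∸ 2 ℕ.* k) * 1ℚ
      ≡⟨ *-identityʳ (x ^ℚ (M ∸ 2 ℕ.* k)) ⟩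
    x ^ℚ (M ∸ 2 ℕ.* k) ∎)
  reversed-term : ∀ k → k ℕ.≤ suc s → ρ s x (suc s ∸ k) ≡ x ^ℚ M * ρ s y k
  reversed-term k k≤ = begin
    ρ s x (suc s ∸ k)
      ≡⟨ ρ≡β*β s x (suc s ∸ k) ⟩
    β (2 ℕ.* (suc s ∸ k)) * β (M ∸ 2 ℕ.* (suc s ∸ k)) * x ^ℚ (2 ℕ.* (suc s ∸ k))
      ≡⟨ cong (λ i → β i * β (M ∸ i) * x ^ℚ i) (2[1+s∸k] s k) ⟩
    β (M ∸ 2 ℕ.* k) * β (M ∸ (M ∸ 2 ℕ.* k)) * x ^ℚ (M ∸ 2 ℕ.* k)
      ≡⟨ cong₂ (λ i X → β (M ∸ 2 ℕ.* k) * β i * X) (ℕP.m∸[m∸n]≡n (2k≤2s+2 s k k≤)) (complementary-power k k≤) ⟩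
    β (M ∸ 2 ℕ.* k) * β (2 ℕ.* k) * (x ^ℚ M * y ^ℚ (2 ℕ.* k))
      ≡⟨ solve 4 (λ a b X Y → a :* b :* (X :* Y) := X :* (b :* a :* Y)) refl
           (β (M ∸ 2 ℕ.* k)) (β (2 ℕ.* k)) (x ^ℚ M) (y ^ℚ (2 ℕ.* k)) ⟩
    x ^ℚ M * (β (2 ℕ.* k) * β (M ∸ 2 ℕ.* k) * y ^ℚ (2 ℕ.* k))
      ≡⟨ cong (x ^ℚ M *_) (sym (ρ≡β*β s y k)) ⟩
    x ^ℚ M * ρ s y k ∎

Q-odd : ∀ s z → Q (2 ℕ.* s ℕ.+ 1) z ≡ R s z
Q-odd s z = begin
  Q (2 ℕ.* s ℕ.+ 1) z
    ≡⟨ cong (λ N → sumTo (N ℕ./ 2) (q N)) (sym (ℕP.+-suc (2 ℕ.* s) 1)) ⟩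
  sumTo (M ℕ./ 2) (q M)    ≡⟨ cong (λ w → sumTo w (q M)) (⌊[2s+2]/2⌋ s) ⟩
  sumTo (suc s) (q M)      ≡⟨ sumTo-cong (suc s) term ⟩
  R s z                    ∎
  where
  open ≡-Reasoning
  M = 2 ℕ.* s ℕ.+ 2
  q : ℕ → ℕ → ℚ
  q N k = B* (N ∸ 2 ℕ.* k) * B* (2 ℕ.* k) * inv! (N ∸ 2 ℕ.* k) * inv! (2 ℕ.* k) * z ^ℚ (2 ℕ.* k)
  B*-complement : ∀ k → B* (M ∸ 2 ℕ.* k) ≡ B (M ∸ 2 ℕ.* k)
  B*-complement k = subst (λ w → B* w ≡ B w) (2[1+s∸k] s k) (B*-even (suc s ∸ k))
  term : ∀ k → q M k ≡ ρ s z k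
  term k = trans
    (cong₂ (λ u v → u * v * inv! (M ∸ 2 ℕ.* k) * inv! (2 ℕ.* k) * z ^ℚ (2 ℕ.* k)) (B*-complement k) (B*-even k))
    (solve 5 (λ a c i j p → a :* c :* i :* j :* p := c :* a :* j :* i :* p) refl
       (B (M ∸ 2 ℕ.* k)) (B (2 ℕ.* k)) (inv! (M ∸ 2 ℕ.* k)) (inv! (2 ℕ.* k)) (z ^ℚ (2 ℕ.* k)))

κ : ℕ → ℚ → ℕ → ℚ
κ s z k = B* (suc (2 ℕ.* s) ∸ 2 ℕ.* k) * B* (2 ℕ.* k)
  * inv! (suc (2 ℕ.* s) ∸ 2 ℕ.* k) * inv! (2 ℕ.* k) * z ^ℚ (2 ℕ.* k)

sumTo-scaled-difference : ∀ n a c (f g : ℕ → ℚ) →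
  a * (sumTo n f - c * sumTo n g) ≡ sumTo n (λ k → a * (f k - c * g k))
sumTo-scaled-difference n a c f g = begin
  a * (sumTo n f - c * sumTo n g)
    ≡⟨ cong (λ w → a * (sumTo n f + w)) (trans (cong -_ (sumTo-*ˡ n c g)) (sumTo-neg n (λ k → c * g k))) ⟩
  a * (sumTo n f + sumTo n (λ k → - (c * g k)))
    ≡⟨ cong (a *_) (sym (sumTo-+ n f (λ k → - (c * g k)))) ⟩
  a * sumTo n (λ k → f k - c * g k)
    ≡⟨ sumTo-*ˡ n a (λ k → f k - c * g k) ⟩
  sumTo n (λ k → a * (f k - c * g k)) ∎
  where open ≡-Reasoning

-- 2^{−(2s+2)} 2^{2k} = 2^{−1} 2^{−(2(s−k)+1)}, since 2s + 2 = 1 + (2(s−k)+1) + 2k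
inv2^-split : ∀ s k → k ℕ.≤ s →
  inv2^ (2 ℕ.* s ℕ.+ 2) * two ^ℚ (2 ℕ.* k) ≡ inv2^ 1 * inv2^ (suc (2 ℕ.* (s ∸ k)))
inv2^-split s k k≤ = begin
  inv2^ (2 ℕ.* s ℕ.+ 2) * two ^ℚ (2 ℕ.* k)
    ≡⟨ cong (λ w → inv2^ w * two ^ℚ (2 ℕ.* k))
         (trans (sym (ℕP.m∸n+n≡m (2k≤2s+2 s k (ℕP.m≤n⇒m≤1+n k≤)))) (cong (ℕ._+ 2 ℕ.* k) ([2s+2]∸2k s k k≤))) ⟩
  inv2^ (m ℕ.+ 2 ℕ.* k) * two ^ℚ (2 ℕ.* k)            ≡⟨ cong (_* two ^ℚ (2 ℕ.* k)) (inv2^-+ m (2 ℕ.* k)) ⟩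
  inv2^ m * inv2^ (2 ℕ.* k) * two ^ℚ (2 ℕ.* k)        ≡⟨ *-assoc (inv2^ m) (inv2^ (2 ℕ.* k)) (two ^ℚ (2 ℕ.* k)) ⟩
  inv2^ m * (inv2^ (2 ℕ.* k) * two ^ℚ (2 ℕ.* k))      ≡⟨ cong (inv2^ m *_) (inv2^*2^ (2 ℕ.* k)) ⟩
  inv2^ m * 1ℚ                                       ≡⟨ *-identityʳ (inv2^ m) ⟩
  inv2^ (1 ℕ.+ suc (2 ℕ.* (s ∸ k)))                  ≡⟨ inv2^-+ 1 (suc (2 ℕ.* (s ∸ k))) ⟩
  inv2^ 1 * inv2^ (suc (2 ℕ.* (s ∸ k)))              ∎
  where
  open ≡-Reasoning
  m = suc (suc (2 ℕ.* (s ∸ k)))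

module _ (s : ℕ) (z : ℚ) where
  private
    N = 2 ℕ.* s ℕ.+ 2
    c = inv2^ N

  κ≡ρ-difference : ∀ k → k ℕ.≤ s → κ s z k ≡ four * (ρ s z k - c * ρ s (two * z) k)
  κ≡ρ-difference k k≤ = begin
    κ s z k
      ≡⟨ cong (λ w → B* w * B* (2 ℕ.* k) * inv! w * inv! (2 ℕ.* k) * Z) ([2s+1]∸2k s k k≤) ⟩
    B* o * B* (2 ℕ.* k) * inv! o * inv! (2 ℕ.* k) * Z
      ≡⟨ solve 5 (λ a c i j p → a :* c :* i :* j :* p := (a :* i) :* (c :* j) :* p) refl
           (B* o) (B* (2 ℕ.* k)) (inv! o) (inv! (2 ℕ.* k)) Z ⟩
    (B* o * inv! o) * (B* (2 ℕ.* k) * inv! (2 ℕ.* k)) * Z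
      ≡⟨ cong₂ (λ u v → u * (v * inv! (2 ℕ.* k)) * Z) (B*-odd (s ∸ k)) (B*-even k) ⟩
    (four - two * inv2^ o) * β m * β (2 ℕ.* k) * Z
      ≡⟨ solve 4 (λ q b b′ Z → (con four :- con two :* q) :* b :* b′ :* Z
                   := con four :* (b′ :* b :* Z :- (con (inv2^ 1) :* q) :* (b′ :* b :* Z))) refl
           (inv2^ o) (β m) (β (2 ℕ.* k)) Z ⟩
    four * (β (2 ℕ.* k) * β m * Z - (inv2^ 1 * inv2^ o) * (β (2 ℕ.* k) * β m * Z))
      ≡⟨ cong (λ w → four * (β (2 ℕ.* k) * β m * Z - w * (β (2 ℕ.* k) * β m * Z))) (sym (inv2^-split s k k≤)) ⟩
    four * (β (2 ℕ.* k) * β m * Z - (c * two ^ℚ (2 ℕ.* k)) * (β (2 ℕ.* k) * β m * Z))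
      ≡⟨ solve 4 (λ c p a Z → con four :* (a :* Z :- (c :* p) :* (a :* Z)) := con four :* (a :* Z :- c :* (a :* (p :* Z))))
           refl c (two ^ℚ (2 ℕ.* k)) (β (2 ℕ.* k) * β m) Z ⟩
    four * (β (2 ℕ.* k) * β m * Z - c * (β (2 ℕ.* k) * β m * (two ^ℚ (2 ℕ.* k) * Z)))
      ≡⟨ cong₂ (λ u v → four * (u - c * v))
           (sym (trans (ρ≡β*β s z k) (cong (λ i → β (2 ℕ.* k) * β i * Z) ([2s+2]∸2k s k k≤))))
           (sym (trans (ρ≡β*β s (two * z) k)
                  (cong₂ (λ i X → β (2 ℕ.* k) * β i * X) ([2s+2]∸2k s k k≤) (^-distrib-* two z (2 ℕ.* k))))) ⟩
    four * (ρ s z k - c * ρ s (two * z) k) ∎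
    where
    open ≡-Reasoning
    o = suc (2 ℕ.* (s ∸ k))
    m = suc o
    Z = z ^ℚ (2 ℕ.* k)

  -- The top term of R(z) − 2^{−N} R(2z) vanishes: ρ_{s+1}(2z) = 2^N ρ_{s+1}(z).
  top-term-cancels : four * (ρ s z (suc s) - c * ρ s (two * z) (suc s)) ≡ 0ℚ
  top-term-cancels = begin
    four * (K * Z - c * (K * (two * z) ^ℚ (2 ℕ.* suc s)))
      ≡⟨ cong (λ w → four * (K * Z - c * (K * w))) (^-distrib-* two z (2 ℕ.* suc s)) ⟩
    four * (K * Z - c * (K * (two ^ℚ (2 ℕ.* suc s) * Z)))
      ≡⟨ solve 4 (λ K Z c p → con four :* (K :* Z :- c :* (K :* (p :* Z))) := con four :* K :* Z :* (con 1ℚ :- c :* p))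
           refl K Z c (two ^ℚ (2 ℕ.* suc s)) ⟩
    four * K * Z * (1ℚ - c * two ^ℚ (2 ℕ.* suc s))
      ≡⟨ cong (λ w → four * K * Z * (1ℚ - c * two ^ℚ w)) (sym (2s+2≡2[1+s] s)) ⟩
    four * K * Z * (1ℚ - c * two ^ℚ N)
      ≡⟨ cong (λ w → four * K * Z * (1ℚ - w)) (inv2^*2^ N) ⟩
    four * K * Z * (1ℚ - 1ℚ)
      ≡⟨ *-zeroʳ (four * K * Z) ⟩
    0ℚ ∎
    where
    open ≡-Reasoning
    K = B (2 ℕ.* suc s) * B (N ∸ 2 ℕ.* suc s) * inv! (2 ℕ.* suc s) * inv! (N ∸ 2 ℕ.* suc s)
    Z = z ^ℚ (2 ℕ.* suc s)

  Q-even : Q (2 ℕ.* s) z ≡ four * (R s z - c * R s (two * z))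
  Q-even = sym (begin
    four * (R s z - c * R s (two * z))
      ≡⟨ sumTo-scaled-difference (suc s) four c (ρ s z) (ρ s (two * z)) ⟩
    sumTo s (λ k → four * (ρ s z k - c * ρ s (two * z) k)) + four * (ρ s z (suc s) - c * ρ s (two * z) (suc s))
      ≡⟨ cong₂ _+_ (sumTo-cong≤ s (λ k k≤ → sym (κ≡ρ-difference k k≤))) top-term-cancels ⟩
    sumTo s (κ s z) + 0ℚ                ≡⟨ +-identityʳ (sumTo s (κ s z)) ⟩
    sumTo s (κ s z)                     ≡⟨ cong (λ w → sumTo w (κ s z)) (sym (⌊[2s+1]/2⌋ s)) ⟩
    Q (2 ℕ.* s) z                       ∎)
    where open ≡-Reasoning

Q-even-½ : ∀ s x → Q (2 ℕ.* s) (½ * x) ≡ four * (R s (½ * x) - inv2^ (2 ℕ.* s ℕ.+ 2) * R s x)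
Q-even-½ s x = trans (Q-even s (½ * x)) (cong (λ v → four * (R s (½ * x) - inv2^ (2 ℕ.* s ℕ.+ 2) * R s v)) (2*½ x))

-- Reciprocal forms of Q_{2s}, from the symmetry of R at z, 2z and z/2.

module _ (s : ℕ) (z : ℚ) .{{_ : NonZero z}} where
  private
    N = 2 ℕ.* s ℕ.+ 2
    c = inv2^ N
    Z = z ^ℚ N
    w = 1/ z
    z*w≡1 : z * w ≡ 1ℚ
    z*w≡1 = *-inverseʳ z

  R-at-z : R s z ≡ Z * R s w
  R-at-z = R-reciprocal s z w z*w≡1

  R-at-2z : c * R s (two * z) ≡ Z * R s (½ * w)
  R-at-2z = begin
    c * R s (two * z)
      ≡⟨ cong (c *_) (R-reciprocal s (two * z) (½ * w) (reciprocal-scale two ½ z w z*w≡1)) ⟩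
    c * ((two * z) ^ℚ N * R s (½ * w))   ≡⟨ cong (λ v → c * (v * R s (½ * w))) (^-distrib-* two z N) ⟩
    c * (two ^ℚ N * Z * R s (½ * w))
      ≡⟨ solve 4 (λ c P Z r → c :* (P :* Z :* r) := (c :* P) :* (Z :* r)) refl c (two ^ℚ N) Z (R s (½ * w)) ⟩
    (c * two ^ℚ N) * (Z * R s (½ * w))   ≡⟨ cong (_* (Z * R s (½ * w))) (inv2^*2^ N) ⟩
    1ℚ * (Z * R s (½ * w))               ≡⟨ *-identityˡ (Z * R s (½ * w)) ⟩
    Z * R s (½ * w)                      ∎
    where open ≡-Reasoning

  R-at-½z : R s (½ * z) ≡ Z * (c * R s (two * w))
  R-at-½z = begin
    R s (½ * z)                   ≡⟨ R-reciprocal s (½ * z) (two * w) (reciprocal-scale ½ two z w z*w≡1) ⟩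
    (½ * z) ^ℚ N * R s (two * w)  ≡⟨ cong (_* R s (two * w)) (^-distrib-* ½ z N) ⟩
    ½ ^ℚ N * Z * R s (two * w)    ≡⟨ cong (λ v → v * Z * R s (two * w)) (sym (inv2^≡½^ N)) ⟩
    c * Z * R s (two * w)
      ≡⟨ solve 3 (λ c Z r → c :* Z :* r := Z :* (c :* r)) refl c Z (R s (two * w)) ⟩
    Z * (c * R s (two * w))       ∎
    where open ≡-Reasoning

  Q-even-reciprocal : Q (2 ℕ.* s) z ≡ four * Z * (R s w - R s (½ * w))
  Q-even-reciprocal = begin
    Q (2 ℕ.* s) z                           ≡⟨ Q-even s z ⟩
    four * (R s z - c * R s (two * z))      ≡⟨ cong₂ (λ u v → four * (u - v)) R-at-z R-at-2z ⟩
    four * (Z * R s w - Z * R s (½ * w))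
      ≡⟨ solve 3 (λ Z a b → con four :* (Z :* a :- Z :* b) := con four :* Z :* (a :- b)) refl Z (R s w) (R s (½ * w)) ⟩
    four * Z * (R s w - R s (½ * w))        ∎
    where open ≡-Reasoning

  Q-even-two-term : Q (2 ℕ.* s) z - Q (2 ℕ.* s) (½ * z) ≡ Z * (Q (2 ℕ.* s) w - Q (2 ℕ.* s) (½ * w))
  Q-even-two-term = begin
    Q (2 ℕ.* s) z - Q (2 ℕ.* s) (½ * z)
      ≡⟨ cong₂ _-_ (Q-even s z) (Q-even-½ s z) ⟩
    four * (R s z - c * R s (two * z)) - four * (R s (½ * z) - c * R s z)
      ≡⟨ cong₂ (λ u v → four * (u - v) - four * (R s (½ * z) - c * u)) R-at-z R-at-2z ⟩
    four * (Z * Rw - Z * Rhw) - four * (R s (½ * z) - c * (Z * Rw))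
      ≡⟨ cong (λ v → four * (Z * Rw - Z * Rhw) - four * (v - c * (Z * Rw))) R-at-½z ⟩
    four * (Z * Rw - Z * Rhw) - four * (Z * (c * R2w) - c * (Z * Rw))
      ≡⟨ solve 5 (λ Z a b d c → con four :* (Z :* a :- Z :* b) :- con four :* (Z :* (c :* d) :- c :* (Z :* a))
                   := Z :* (con four :* (a :- c :* d) :- con four :* (b :- c :* a))) refl Z Rw Rhw R2w c ⟩
    Z * (four * (Rw - c * R2w) - four * (Rhw - c * Rw))
      ≡⟨ cong (Z *_) (sym (cong₂ _-_ (Q-even s w) (Q-even-½ s w))) ⟩
    Z * (Q (2 ℕ.* s) w - Q (2 ℕ.* s) (½ * w)) ∎
    where
    open ≡-Reasoning
    Rw = R s w
    Rhw = R s (½ * w)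
    R2w = R s (two * w)

theorem1p1 : (s : ℕ) →
      ((z : ℚ) → Q (2 ℕ.* s ℕ.+ 1) z ≡ R s z)
    × ((z : ℚ) → .{{_ : NonZero z}} →
        Q (2 ℕ.* s) z ≡ (+ 4 / 1) * z ^ℚ (2 ℕ.* s ℕ.+ 2) * (R s (1/ z) - R s (½ * (1/ z))))
    × ((z : ℚ) →
        Q (2 ℕ.* s) z ≡ (+ 4 / 1) * (R s z - inv2^ (2 ℕ.* s ℕ.+ 2) * R s ((+ 2 / 1) * z)))
    × ((z : ℚ) → .{{_ : NonZero z}} →
        Q (2 ℕ.* s) z - Q (2 ℕ.* s) (½ * z)
          ≡ z ^ℚ (2 ℕ.* s ℕ.+ 2) * (Q (2 ℕ.* s) (1/ z) - Q (2 ℕ.* s) (½ * (1/ z))))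
theorem1p1 s = Q-odd s , Q-even-reciprocal s , Q-even s , Q-even-two-term s
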